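{- For $m\ge1$ and $n\ge0$, $$\sum_{k\ge0}(-q^{m-1})^{n-k}\,S^o_{\mathrm{CR}}[m,n,k]=[m-1]^n.$$
   Context: $[j]=1+q+\dots+q^{j-1}$ (so $[0]=0$); $[km]!_m=[m][2m]\cdots[km]$ (empty product $1$ for $k=0$). Let $\zeta_m=e^{2\pi i/m}$, $i^c=\zeta_m^c\mathbf e_i$ for $i\in[n]$ (colors mod $m$), $[n^m]=\{0\}\cup\{i^c:i\in[n],0\le c<m\}$, $zS=\{zs:s\in S\}$. A colored set partition of type $(m,n)$ is a set partition of $[n^m]$ into blocks $S_0,\dots,S_{km}$ with (i) $0\in S_0$ and if some $i^c\in S_0$ then all $i^d\in S_0$; (ii) for each $0\le l<k$, $S_{lm+1},\dots,S_{(l+1)m}$ are distinct and of the form $S,\zeta_mS,\dots,\zeta_m^{m-1}S$. For nonempty $S$, $\operatorname{minb}S=0$ if $0\in S$, else the least base in $S$. Standard form: blocks labeled so that (ii) holds, $s_i=\operatorname{minb}S_i$ satisfy $0=s_0<s_m<\dots<s_{km}$, and $s_j^{\,r}\in S_j$ for $j\in[km]$ with $r=j\bmod m$. An inversion is a pair $(i^0,S_l)$ with $i^0\in S_j$, $j<l$, $i\ge s_l$. $S[m,n,k]=\sum q^{\operatorname{inv}\sigma}$ over type $(m,n)$ colored set partitions with $km+1$ blocks, and $S^o_{\mathrm{CR}}[m,n,k]=[km]!_m\,S[m,n,k]$. -}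

module Defs where

open import Level using (Level)
open import Data.Bool using (_≟_; Bool; true; false; _∧_; _∨_; if_then_else_; not)
open import Data.Nat using (ℕ; zero; suc; _∸_; _≡ᵇ_; _<ᵇ_; NonZero)
import Data.Nat as ℕ
open import Data.Nat.DivMod using (_mod_)
open import Data.Fin using (Fin; toℕ)
open import Data.Maybe using (Maybe; just; nothing)
open import Data.Product using (_×_; _,_; proj₁; proj₂)
open import Data.List using (List; []; _∷_; map; filter; length; foldr; allFin; cartesianProduct; upTo; concatMap)
open import Data.Bool.ListAction using (all; any)
open import Algebra.Bundles using (CommutativeRing)

-- Combinatorial encoding of colored set partitions (type (m,n)) with
-- k*m+1 blocks, each given in its (unique) standard form.
--
-- Base i ∈ [n] is represented by  i : Fin n  (base value toℕ i + 1);
-- colors by  c : Fin m.  The element i^c of [n^m] is (i , c); the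
-- element 0 is always in S_0.
-- A block label is  Maybe (Fin k × Fin m):
--   nothing     ↦ S_0
--   just (l,r)  ↦ S_j with j = l*m + r (if r ≠ 0) or j = (l+1)*m (if r = 0),
--                 i.e. the block S_j with lm < j ≤ (l+1)m and j mod m = r.
-- A structure is  g : Fin n → Fin m → Label,  g i c = block containing i^c.

Label : ℕ → ℕ → Set
Label k m = Maybe (Fin k × Fin m)

Assign : ℕ → ℕ → ℕ → Set
Assign n m k = Fin n → Fin m → Label k m

idx : ∀ {k} m → Label k m → ℕ
idx m nothing = 0
idx m (just (l , r)) = toℕ l ℕ.* m ℕ.+ (if toℕ r ≡ᵇ 0 then m else toℕ r)

-- colour shift c ↦ c+1 (mod m), i.e. multiplication by ζ_m
next : ∀ m → .{{_ : NonZero m}} → Fin m → Fin m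
next m c = suc (toℕ c) mod m

-- effect of multiplication by ζ_m on block labels: ζ S_{(l,r)} = S_{(l,r+1)},
-- ζ S_0 = S_0
shift : ∀ {k} m → .{{_ : NonZero m}} → Label k m → Label k m
shift m nothing = nothing
shift m (just (l , r)) = just (l , next m r)

finEq : ∀ {a} → Fin a → Fin a → Bool
finEq x y = toℕ x ≡ᵇ toℕ y

labEq : ∀ {k m} → Label k m → Label k m → Bool
labEq nothing nothing = true
labEq nothing (just _) = false
labEq (just _) nothing = false
labEq (just (l , r)) (just (l' , r')) = finEq l l' ∧ finEq r r'

inGroup : ∀ {k m} → Fin k → Label k m → Bool
inGroup l nothing = false
inGroup l (just (l' , _)) = finEq l l'

-- least toℕ i with p i, or n if there is none
leastℕ : ∀ n → (Fin n → Bool) → ℕ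
leastℕ zero p = zero
leastℕ (suc n) p = if p Fin.zero then zero else suc (leastℕ n (λ i → p (Fin.suc i)))

-- s_{(l+1)m} - 1 = minb of the blocks of group l (all have the same bases),
-- as a 0-based index
minb : ∀ {n m k} → Assign n m k → Fin k → ℕ
minb {n} {m} g l = leastℕ n (λ i → any (λ c → inGroup l (g i c)) (allFin m))

allB : ∀ {a} → (Fin a → Bool) → Bool
allB {a} p = all p (allFin a)

anyB : ∀ {a} → (Fin a → Bool) → Bool
anyB {a} p = any p (allFin a)

-- g describes a colored set partition of type (m,n) with km+1 blocks,
-- labelled in standard form:
--  * the blocks S_{lm+1..(l+1)m} are S, ζS, …, ζ^{m-1}S and ζS_0 = S_0
--    (equivariance: ζ·(i^c) = i^{c+1} lies in ζ·(block of i^c));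
--    this also gives condition (i) for S_0;
--  * every block S_j (j ≥ 1) is nonempty (then they are pairwise distinct,
--    being disjoint);
--  * standard form: s_m < s_{2m} < … < s_{km}  (s_0 = 0 < all automatically),
--    and s_j^{ j mod m } ∈ S_j.
isStandardCSP : ∀ n m k → .{{_ : NonZero m}} → Assign n m k → Bool
isStandardCSP n m k g =
  allB (λ i → allB (λ c → labEq (g i (next m c)) (shift m (g i c))))
  ∧ allB (λ l → allB (λ r → anyB (λ i → anyB (λ c → labEq (g i c) (just (l , r))))))
  ∧ allB (λ l → allB (λ l' → not (toℕ l <ᵇ toℕ l') ∨ (minb g l <ᵇ minb g l')))
  ∧ allB (λ l → allB (λ r → anyB (λ i →
        (toℕ i ≡ᵇ minb g l) ∧ labEq (g i r) (just (l , r)))))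

-- number of inversions: pairs (i^0, S_{j'}) with i^0 ∈ S_j, j < j', i ≥ s_{j'}
-- (the target block S_{j'} is never S_0, since j < j')
countB : ∀ {a} → (Fin a → ℕ) → ℕ
countB {a} f = foldr ℕ._+_ 0 (map f (allFin a))

b2n : Bool → ℕ
b2n true = 1
b2n false = 0

inv : ∀ n m k → .{{_ : NonZero m}} → Assign n m k → ℕ
inv n m k g = countB (λ i → countB (λ l → countB (λ r → b2n
  ((idx m (g i (0 mod m)) <ᵇ idx m (just (l , r)))
   ∧ not (toℕ i <ᵇ minb g l)))))

consF : ∀ {A : Set} {a} → A → (Fin a → A) → Fin (suc a) → A
consF x f Fin.zero = x
consF x f (Fin.suc i) = f i

allFuns : ∀ {A : Set} a → List A → List (Fin a → A)
allFuns zero xs = (λ ()) ∷ []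
allFuns (suc a) xs = concatMap (λ x → map (consF x) (allFuns a xs)) xs

allLabels : ∀ k m → List (Label k m)
allLabels k m = nothing ∷ map just (cartesianProduct (allFin k) (allFin m))

allAssign : ∀ n m k → List (Assign n m k)
allAssign n m k = allFuns n (allFuns m (allLabels k m))

CSPs : ∀ n m k → .{{_ : NonZero m}} → List (Assign n m k)
CSPs n m k = filter (λ g → isStandardCSP n m k g ≟ true) (allAssign n m k)

-- q-analogues, evaluated in an arbitrary commutative ring at q
-- (an identity for all commutative rings and all q is the same as an
-- identity of polynomials in ℤ[q]).

module QAnalogues {c ℓ} (R : CommutativeRing c ℓ) where
  open CommutativeRing R hiding (zero)


  pow : Carrier → ℕ → Carrier
  pow x zero = 1#
  pow x (suc e) = x * pow x e

  sumR : List Carrier → Carrier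
  sumR = foldr _+_ 0#

  qint : Carrier → ℕ → Carrier
  qint q j = sumR (map (pow q) (upTo j))

  qfactm : Carrier → ℕ → ℕ → Carrier
  qfactm q m zero = 1#
  qfactm q m (suc k) = qfactm q m k * qint q (suc k ℕ.* m)

  Sq : Carrier → ∀ m → .{{_ : NonZero m}} → ℕ → ℕ → Carrier
  Sq q m n k = sumR (map (λ g → pow q (inv n m k g)) (CSPs n m k))

  SoCR : Carrier → ∀ m → .{{_ : NonZero m}} → ℕ → ℕ → Carrier
  SoCR q m n k = qfactm q m k * Sq q m n k

{-# OPTIONS --safe #-}
module Submission where

-- Let S n k be the inversion generating function of standard colored set partitions of type
-- (m, n) with km + 1 blocks.  Removing the largest base from one of type (m, n + 1) leaves
-- either one of type (m, n) with the same k, the colour-0 element of the removed base having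
-- lain in one of the km + 1 blocks, of index j say, and contributed km - j inversions; or, when
-- that base alone formed the last group of m blocks, one with k - 1 groups and the same
-- inversions.  Hence S (n+1) k = [km+1] S n k + S n (k-1).  For U n k = [km]!_m S n k this
-- reads U (n+1) (k+1) = [(k+1)m] U n k + [(k+1)m+1] U n (k+1), and since
-- [(k+1)m] - q^(m-1) [km+1] = [m-1], the alternating sums A n = Σ_k (-q^(m-1))^(n-k) U n k
-- satisfy A (n+1) = [m-1] A n and A 0 = 1.
--
-- Sums are taken over all assignments of labels to coloured bases, non-standard ones having
-- weight 0, so that sums over assignments split base by base and colour by colour.

open import Defs
open import Algebra.Bundles using (CommutativeRing; CommutativeMonoid; Monoid)
open import Data.Bool using (Bool; true; false; _∧_; _∨_; not; if_then_else_; T)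
open import Data.Bool.Properties
  using (T-≡; ¬-not; ∧-commutativeMonoid; ∨-commutativeMonoid; ∧-conicalˡ; ∧-conicalʳ; ∧-zeroʳ; ∧-identityʳ; ∨-zeroʳ; ∨-identityʳ)
open import Data.Empty using (⊥-elim)
open import Data.Fin using (Fin; zero; suc; toℕ; fromℕ; inject₁)
open import Data.Fin.Properties using (¬Fin0; toℕ-injective; toℕ<n; toℕ-fromℕ; toℕ-inject₁; toℕ-inject₁-≢; toℕ-fromℕ<)
open import Data.List using (List; []; _∷_; map; foldr; tabulate; applyUpTo; upTo; allFin)
open import Data.Maybe using (just; nothing)
open import Data.Nat using (ℕ; zero; suc; _∸_; _≤_; _<_; z≤n; s≤s; _≡ᵇ_; _<ᵇ_; NonZero)
import Data.Nat as Nat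
open import Data.Nat.DivMod using (_%_; _mod_; %-distribˡ-+; m%n%n≡m%n; m<n⇒m%n≡m; [m+n]%n≡m%n; m%n<n)
open import Data.Nat.Properties using (+-0-commutativeMonoid; ≡ᵇ⇒≡; ≡⇒≡ᵇ; <ᵇ⇒<; <⇒<ᵇ)
open import Data.Product using (∃; _×_; _,_; proj₁; proj₂)
open import Function using (_∘_; id; Equivalence)
open import Relation.Binary.PropositionalEquality
  using (_≡_; refl; sym; trans; cong; cong₂; subst; subst₂; module ≡-Reasoning)
open import Relation.Nullary using (¬_)

contradictionᵇ : ∀ {a} {A : Set a} {b} → b ≡ true → b ≡ false → A
contradictionᵇ refl ()

∧-cong-guarded : ∀ {a a′ b b′ c c′ : Bool} → a ≡ a′ → b ≡ b′ → (b′ ≡ true → c ≡ c′) → a ∧ (b ∧ c) ≡ a′ ∧ (b′ ∧ c′)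
∧-cong-guarded {b′ = false} refl refl _ = refl
∧-cong-guarded {b′ = true} refl refl c≡c′ = cong (_ ∧_) (c≡c′ refl)

T⇒≡true : ∀ {b} → T b → b ≡ true
T⇒≡true = Equivalence.to T-≡

≡true⇒T : ∀ {b} → b ≡ true → T b
≡true⇒T = Equivalence.from T-≡

¬T⇒≡false : ∀ {b} → ¬ T b → b ≡ false
¬T⇒≡false ¬b = ¬-not (¬b ∘ ≡true⇒T)

module FoldOverFin {a ℓ} (M : Monoid a ℓ) where
  open Monoid M using (Carrier; _∙_; ε; _≈_; setoid)
  open import Algebra.Properties.Monoid.Sum M public using (sum; sum-cong-≗; sum-init-last; sum-replicate-zero)
  open import Data.List.Properties using (map-cong)
  open import Relation.Binary.Reasoning.Setoid setoid

  foldr-map-applyUpTo : ∀ {b} {B : Set b} (f : B → Carrier) (g : ℕ → B) N →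
    foldr _∙_ ε (map f (applyUpTo g N)) ≡ sum {N} (f ∘ g ∘ toℕ)
  foldr-map-applyUpTo f g zero = refl
  foldr-map-applyUpTo f g (suc N) = cong (f (g 0) ∙_) (foldr-map-applyUpTo f (g ∘ suc) N)

  foldr-map-tabulate : ∀ {b} {B : Set b} {n} (f : B → Carrier) (g : Fin n → B) →
    foldr _∙_ ε (map f (tabulate g)) ≡ sum {n} (f ∘ g)
  foldr-map-tabulate {n = zero} f g = refl
  foldr-map-tabulate {n = suc n} f g = cong (f (g zero) ∙_) (foldr-map-tabulate f (g ∘ suc))

  foldAll : ∀ {n} → (Fin n → Carrier) → Carrier
  foldAll {n} f = foldr _∙_ ε (map f (allFin n))

  foldAll≡sum : ∀ {n} (f : Fin n → Carrier) → foldAll f ≡ sum f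
  foldAll≡sum f = foldr-map-tabulate f id

  foldAll-head-tail : ∀ {n} (f : Fin (suc n) → Carrier) → foldAll f ≡ f zero ∙ foldAll (f ∘ suc)
  foldAll-head-tail f = trans (foldAll≡sum f) (cong (f zero ∙_) (sym (foldAll≡sum (f ∘ suc))))

  foldAll-cong : ∀ {n} {f g : Fin n → Carrier} → (∀ i → f i ≡ g i) → foldAll f ≡ foldAll g
  foldAll-cong {n} f≗g = cong (foldr _∙_ ε) (map-cong f≗g (allFin n))

  foldAll-init-last : ∀ {n} (f : Fin (suc n) → Carrier) →
    foldAll f ≈ foldAll (f ∘ inject₁) ∙ f (fromℕ n)
  foldAll-init-last {n} f = begin
    foldAll f                           ≡⟨ foldAll≡sum f ⟩
    sum f                               ≈⟨ sum-init-last f ⟩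
    sum (f ∘ inject₁) ∙ f (fromℕ n)     ≡⟨ cong (_∙ f (fromℕ n)) (foldAll≡sum (f ∘ inject₁)) ⟨
    foldAll (f ∘ inject₁) ∙ f (fromℕ n) ∎

  foldAll-ε : ∀ n → foldAll {n} (λ _ → ε) ≈ ε
  foldAll-ε n = begin
    foldAll {n} (λ _ → ε) ≡⟨ foldAll≡sum {n} (λ _ → ε) ⟩
    sum {n} (λ _ → ε)     ≈⟨ sum-replicate-zero n ⟩
    ε                     ∎

module SumUpTo {a ℓ} (M : CommutativeMonoid a ℓ) where
  open CommutativeMonoid M
    using (Carrier; _∙_; _≈_; setoid; reflexive; ∙-cong; ∙-congˡ; ∙-congʳ; assoc; comm; identityʳ)
    renaming (refl to ≈-refl; sym to ≈-sym; trans to ≈-trans)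
  open import Algebra.Properties.CommutativeMonoid.Sum M using (sum; sum-cong-≋; sum-cong-≗; sum-init-last)
  open import Relation.Binary.Reasoning.Setoid setoid
  open Nat using (_+_; _*_)
  open import Data.Nat.Properties using (+-identityʳ; +-suc; +-comm)

  sumUpTo : ℕ → (ℕ → Carrier) → Carrier
  sumUpTo N φ = sum {N} (φ ∘ toℕ)

  sumUpTo-cong : ∀ N {φ ψ : ℕ → Carrier} → (∀ s → φ s ≈ ψ s) → sumUpTo N φ ≈ sumUpTo N ψ
  sumUpTo-cong N φ≈ψ = sum-cong-≋ {N} (φ≈ψ ∘ toℕ)

  sumUpTo-last : ∀ N (φ : ℕ → Carrier) → sumUpTo (suc N) φ ≈ sumUpTo N φ ∙ φ N
  sumUpTo-last N φ = ≈-trans (sum-init-last {N} (φ ∘ toℕ))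
    (reflexive (cong₂ _∙_ (sum-cong-≗ {N} λ i → cong φ (toℕ-inject₁ i)) (cong φ (toℕ-fromℕ N))))

  sumUpTo-+ : ∀ a b (φ : ℕ → Carrier) → sumUpTo (a + b) φ ≈ sumUpTo a φ ∙ sumUpTo b (φ ∘ (a +_))
  sumUpTo-+ a zero φ rewrite +-identityʳ a = ≈-sym (identityʳ _)
  sumUpTo-+ a (suc b) φ rewrite +-suc a b = begin
    sumUpTo (suc (a + b)) φ                              ≈⟨ sumUpTo-last (a + b) φ ⟩
    sumUpTo (a + b) φ ∙ φ (a + b)                        ≈⟨ ∙-congʳ (sumUpTo-+ a b φ) ⟩
    (sumUpTo a φ ∙ sumUpTo b (φ ∘ (a +_))) ∙ φ (a + b)   ≈⟨ assoc _ _ _ ⟩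
    sumUpTo a φ ∙ (sumUpTo b (φ ∘ (a +_)) ∙ φ (a + b))   ≈⟨ ∙-congˡ (sumUpTo-last b (φ ∘ (a +_))) ⟨
    sumUpTo a φ ∙ sumUpTo (suc b) (φ ∘ (a +_))           ∎

  sumUpTo-reverse : ∀ N (φ : ℕ → Carrier) → sumUpTo (suc N) (φ ∘ (N ∸_)) ≈ sumUpTo (suc N) φ
  sumUpTo-reverse zero φ = ≈-refl
  sumUpTo-reverse (suc N) φ = begin
    φ (suc N) ∙ sumUpTo (suc N) (φ ∘ (N ∸_)) ≈⟨ ∙-congˡ (sumUpTo-reverse N φ) ⟩
    φ (suc N) ∙ sumUpTo (suc N) φ            ≈⟨ comm _ _ ⟩
    sumUpTo (suc N) φ ∙ φ (suc N)            ≈⟨ sumUpTo-last (suc N) φ ⟨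
    sumUpTo (suc (suc N)) φ                  ∎

  -- As (l , r) ranges over Fin k × Fin m, idx m (just (l , r)) ranges over 1, …, km exactly once.
  sumUpTo-blocks : ∀ m′ k (ψ : ℕ → Carrier) →
    sum {k} (λ l → sum {suc m′} λ r → ψ (idx (suc m′) (just (l , r)))) ≈ sumUpTo (k * suc m′) (ψ ∘ suc)
  sumUpTo-blocks m′ zero ψ = ≈-refl
  sumUpTo-blocks m′ (suc k) ψ = begin
    sum {suc k} (λ l → block (toℕ l))
      ≈⟨ sum-init-last {k} (λ l → block (toℕ l)) ⟩
    sum {k} (λ l → block (toℕ (inject₁ l))) ∙ block (toℕ (fromℕ k))
      ≡⟨ cong₂ _∙_ (sum-cong-≗ {k} λ l → cong block (toℕ-inject₁ l)) (cong block (toℕ-fromℕ k)) ⟩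
    sum {k} (λ l → block (toℕ l)) ∙ block k
      ≈⟨ ∙-cong (sumUpTo-blocks m′ k ψ) (≈-trans (comm _ _) (≈-sym (sumUpTo-last m′ (λ t → ψ (k * m + suc t))))) ⟩
    sumUpTo (k * m) (ψ ∘ suc) ∙ sumUpTo m (λ t → ψ (k * m + suc t))
      ≡⟨ cong (sumUpTo (k * m) (ψ ∘ suc) ∙_) (sum-cong-≗ {m} λ t → cong ψ (+-suc (k * m) (toℕ t))) ⟩
    sumUpTo (k * m) (ψ ∘ suc) ∙ sumUpTo m (λ t → ψ (suc (k * m + t)))
      ≈⟨ sumUpTo-+ (k * m) m (ψ ∘ suc) ⟨
    sumUpTo (k * m + m) (ψ ∘ suc)
      ≡⟨ cong (λ N → sumUpTo N (ψ ∘ suc)) (+-comm (k * m) m) ⟩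
    sumUpTo (suc k * m) (ψ ∘ suc) ∎
    where
    m = suc m′
    block : ℕ → Carrier
    block j = sum {m} λ r → ψ (j * m + (if toℕ r ≡ᵇ 0 then m else toℕ r))

module ∧-Fold = FoldOverFin (CommutativeMonoid.monoid ∧-commutativeMonoid)
module ∨-Fold = FoldOverFin (CommutativeMonoid.monoid ∨-commutativeMonoid)
module +-Fold = FoldOverFin (CommutativeMonoid.monoid +-0-commutativeMonoid)

module _ {n : ℕ} where

  allB-cong : {p p′ : Fin n → Bool} → (∀ i → p i ≡ p′ i) → allB p ≡ allB p′
  allB-cong = ∧-Fold.foldAll-cong

  anyB-cong : {p p′ : Fin n → Bool} → (∀ i → p i ≡ p′ i) → anyB p ≡ anyB p′
  anyB-cong = ∨-Fold.foldAll-cong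

  countB-cong : {f f′ : Fin n → ℕ} → (∀ i → f i ≡ f′ i) → countB f ≡ countB f′
  countB-cong = +-Fold.foldAll-cong

  allB-true⁻ : (p : Fin n → Bool) → allB p ≡ true → ∀ i → p i ≡ true
  allB-true⁻ p h = sum-true⁻ p (trans (sym (∧-Fold.foldAll≡sum p)) h)
    where
    sum-true⁻ : ∀ {n} (p : Fin n → Bool) → ∧-Fold.sum p ≡ true → ∀ i → p i ≡ true
    sum-true⁻ p h zero = ∧-conicalˡ _ _ h
    sum-true⁻ p h (suc i) = sum-true⁻ (p ∘ suc) (∧-conicalʳ _ _ h) i

  allB-true⁺ : (p : Fin n → Bool) → (∀ i → p i ≡ true) → allB p ≡ true
  allB-true⁺ p h = trans (∧-Fold.foldAll≡sum p) (sum-true⁺ p h)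
    where
    sum-true⁺ : ∀ {n} (p : Fin n → Bool) → (∀ i → p i ≡ true) → ∧-Fold.sum p ≡ true
    sum-true⁺ {zero} p h = refl
    sum-true⁺ {suc n} p h = cong₂ _∧_ (h zero) (sum-true⁺ (p ∘ suc) (h ∘ suc))

  anyB-true⁻ : (p : Fin n → Bool) → anyB p ≡ true → ∃ λ i → p i ≡ true
  anyB-true⁻ p h = sum-true⁻ p (trans (sym (∨-Fold.foldAll≡sum p)) h)
    where
    sum-true⁻ : ∀ {n} (p : Fin n → Bool) → ∨-Fold.sum p ≡ true → ∃ λ i → p i ≡ true
    sum-true⁻ {suc n} p h with p zero in p₀
    ... | true = zero , p₀
    ... | false = let i , pᵢ = sum-true⁻ (p ∘ suc) h in suc i , pᵢ

  anyB-true⁺ : (p : Fin n → Bool) (i : Fin n) → p i ≡ true → anyB p ≡ true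
  anyB-true⁺ p i h = trans (∨-Fold.foldAll≡sum p) (sum-true⁺ p i h)
    where
    sum-true⁺ : ∀ {n} (p : Fin n → Bool) (i : Fin n) → p i ≡ true → ∨-Fold.sum p ≡ true
    sum-true⁺ p zero h = cong (_∨ ∨-Fold.sum (p ∘ suc)) h
    sum-true⁺ p (suc i) h = trans (cong (p zero ∨_) (sum-true⁺ (p ∘ suc) i h)) (∨-zeroʳ (p zero))

  anyB-false⁺ : (p : Fin n → Bool) → (∀ i → p i ≡ false) → anyB p ≡ false
  anyB-false⁺ p h with anyB p in any-p
  ... | false = refl
  ... | true = let i , pᵢ = anyB-true⁻ p any-p in trans (sym pᵢ) (h i)

  anyB-false⁻ : (p : Fin n → Bool) → anyB p ≡ false → ∀ i → p i ≡ false
  anyB-false⁻ p h i with p i in pᵢ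
  ... | false = refl
  ... | true = trans (sym (anyB-true⁺ p i pᵢ)) h

  allB-false⁻ : (p : Fin n → Bool) → allB p ≡ false → ∃ λ i → p i ≡ false
  allB-false⁻ p h = sum-false⁻ p (trans (sym (∧-Fold.foldAll≡sum p)) h)
    where
    sum-false⁻ : ∀ {n} (p : Fin n → Bool) → ∧-Fold.sum p ≡ false → ∃ λ i → p i ≡ false
    sum-false⁻ {suc n} p h with p zero in p₀
    ... | false = zero , p₀
    ... | true = let i , pᵢ = sum-false⁻ (p ∘ suc) h in suc i , pᵢ

allB-head-tail : ∀ {n} (p : Fin (suc n) → Bool) → allB p ≡ p zero ∧ allB (p ∘ suc)
allB-head-tail = ∧-Fold.foldAll-head-tail

allB-init-last : ∀ {n} (p : Fin (suc n) → Bool) → allB p ≡ allB (p ∘ inject₁) ∧ p (fromℕ n)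
allB-init-last = ∧-Fold.foldAll-init-last

anyB-init-last : ∀ {n} (p : Fin (suc n) → Bool) → anyB p ≡ anyB (p ∘ inject₁) ∨ p (fromℕ n)
anyB-init-last = ∨-Fold.foldAll-init-last

countB-init-last : ∀ {n} (f : Fin (suc n) → ℕ) → countB f ≡ countB (f ∘ inject₁) Nat.+ f (fromℕ n)
countB-init-last = +-Fold.foldAll-init-last

countB-zero : ∀ n → countB {n} (λ _ → 0) ≡ 0
countB-zero = +-Fold.foldAll-ε

leastℕ-cong : ∀ {n} {p p′ : Fin n → Bool} → (∀ i → p i ≡ p′ i) → leastℕ n p ≡ leastℕ n p′
leastℕ-cong {n = zero} h = refl
leastℕ-cong {n = suc n} {p′ = p′} h rewrite h zero =
  cong (λ l → if p′ zero then zero else suc l) (leastℕ-cong (h ∘ suc))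

leastℕ-< : ∀ {n} (p : Fin n → Bool) (i : Fin n) → p i ≡ true → leastℕ n p < n
leastℕ-< p zero h rewrite h = s≤s z≤n
leastℕ-< p (suc i) h with p zero
... | true = s≤s z≤n
... | false = s≤s (leastℕ-< (p ∘ suc) i h)

leastℕ-init : ∀ {n} (p : Fin (suc n) → Bool) (i : Fin n) → p (inject₁ i) ≡ true →
  leastℕ (suc n) p ≡ leastℕ n (p ∘ inject₁)
leastℕ-init p zero h rewrite h = refl
leastℕ-init p (suc i) h with p zero
... | true = refl
... | false = cong suc (leastℕ-init (p ∘ suc) i h)

leastℕ-last : ∀ {n} (p : Fin (suc n) → Bool) → (∀ i → p (inject₁ i) ≡ false) → p (fromℕ n) ≡ true →
  leastℕ (suc n) p ≡ n
leastℕ-last {n = zero} p _ h rewrite h = refl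
leastℕ-last {n = suc n} p h₀ h rewrite h₀ zero = cong suc (leastℕ-last (p ∘ suc) (h₀ ∘ suc) h)

data InitOrLast {n : ℕ} : Fin (suc n) → Set where
  init : (j : Fin n) → InitOrLast (inject₁ j)
  last : InitOrLast (fromℕ n)

initOrLast : ∀ {n} (i : Fin (suc n)) → InitOrLast i
initOrLast {zero} zero = last
initOrLast {suc n} zero = init zero
initOrLast {suc n} (suc i) with initOrLast i
... | init j = init (suc j)
... | last = last

snoc : ∀ {A : Set} {n} → (Fin n → A) → A → Fin (suc n) → A
snoc {n = zero} f x zero = x
snoc {n = suc n} f x zero = f zero
snoc {n = suc n} f x (suc i) = snoc (f ∘ suc) x i

snoc-congʳ : ∀ {A B : Set} {n} (f : Fin n → B → A) {h h′ : B → A} →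
  (∀ c → h c ≡ h′ c) → ∀ i c → snoc f h i c ≡ snoc f h′ i c
snoc-congʳ {n = zero} f h≗h′ zero c = h≗h′ c
snoc-congʳ {n = suc n} f h≗h′ zero c = refl
snoc-congʳ {n = suc n} f h≗h′ (suc i) c = snoc-congʳ (f ∘ suc) h≗h′ i c

snoc-congˡ : ∀ {A B : Set} {n} {f f′ : Fin n → B → A} {h : B → A} →
  (∀ i c → f i c ≡ f′ i c) → ∀ i c → snoc f h i c ≡ snoc f′ h i c
snoc-congˡ {n = zero} f≗f′ zero c = refl
snoc-congˡ {n = suc n} f≗f′ zero c = f≗f′ zero c
snoc-congˡ {n = suc n} f≗f′ (suc i) c = snoc-congˡ (f≗f′ ∘ suc) i c

snoc-inject₁ : ∀ {A : Set} {n} (f : Fin n → A) x (i : Fin n) → snoc f x (inject₁ i) ≡ f i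
snoc-inject₁ {n = suc n} f x zero = refl
snoc-inject₁ {n = suc n} f x (suc i) = snoc-inject₁ (f ∘ suc) x i

snoc-fromℕ : ∀ {A : Set} {n} (f : Fin n → A) x → snoc f x (fromℕ n) ≡ x
snoc-fromℕ {n = zero} f x = refl
snoc-fromℕ {n = suc n} f x = snoc-fromℕ (f ∘ suc) x

finEq-true⁻ : ∀ {a} (x y : Fin a) → finEq x y ≡ true → x ≡ y
finEq-true⁻ x y h = toℕ-injective (≡ᵇ⇒≡ (toℕ x) (toℕ y) (≡true⇒T h))

finEq-refl : ∀ {a} (x : Fin a) → finEq x x ≡ true
finEq-refl x = T⇒≡true (≡⇒≡ᵇ (toℕ x) (toℕ x) refl)

labEq-true⁻ : ∀ {k m} (x y : Label k m) → labEq x y ≡ true → x ≡ y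
labEq-true⁻ nothing nothing h = refl
labEq-true⁻ (just (l , r)) (just (l′ , r′)) h =
  cong₂ (λ l r → just (l , r)) (finEq-true⁻ l l′ (∧-conicalˡ _ _ h)) (finEq-true⁻ r r′ (∧-conicalʳ _ _ h))

labEq-refl : ∀ {k m} (x : Label k m) → labEq x x ≡ true
labEq-refl nothing = refl
labEq-refl (just (l , r)) = cong₂ _∧_ (finEq-refl l) (finEq-refl r)

labEq-≡ : ∀ {k m} {x y : Label k m} → x ≡ y → labEq x y ≡ true
labEq-≡ {x = x} refl = labEq-refl x

module Colours (m′ : ℕ) where
  open Nat using (_+_)
  open import Data.Nat.Properties using (+-suc; +-assoc; +-comm; m+[n∸m]≡n; <⇒≤)
  open ≡-Reasoning

  m : ℕ
  m = suc m′

  %-absorbʳ : ∀ a b → (a + b % m) % m ≡ (a + b) % m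
  %-absorbʳ a b = begin
    (a + b % m) % m         ≡⟨ %-distribˡ-+ a (b % m) m ⟩
    (a % m + b % m % m) % m ≡⟨ cong (λ x → (a % m + x) % m) (m%n%n≡m%n b m) ⟩
    (a % m + b % m) % m     ≡⟨ %-distribˡ-+ a b m ⟨
    (a + b) % m             ∎

  nextⁿ : ℕ → Fin m → Fin m
  nextⁿ zero r = r
  nextⁿ (suc j) r = next m (nextⁿ j r)

  toℕ-nextⁿ : ∀ j r → toℕ (nextⁿ j r) ≡ (toℕ r + j) % m
  toℕ-nextⁿ zero r = sym (trans (cong (_% m) (+-comm (toℕ r) 0)) (m<n⇒m%n≡m (toℕ<n r)))
  toℕ-nextⁿ (suc j) r = begin
    toℕ (next m (nextⁿ j r))  ≡⟨ toℕ-fromℕ< _ ⟩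
    suc (toℕ (nextⁿ j r)) % m ≡⟨ cong (λ x → suc x % m) (toℕ-nextⁿ j r) ⟩
    (1 + (toℕ r + j) % m) % m ≡⟨ %-absorbʳ 1 (toℕ r + j) ⟩
    suc (toℕ r + j) % m       ≡⟨ cong (_% m) (+-suc (toℕ r) j) ⟨
    (toℕ r + suc j) % m       ∎

  nextⁿ-next : ∀ c r → nextⁿ (toℕ (next m c)) r ≡ next m (nextⁿ (toℕ c) r)
  nextⁿ-next c r = toℕ-injective (begin
    toℕ (nextⁿ (toℕ (next m c)) r)    ≡⟨ toℕ-nextⁿ _ r ⟩
    (toℕ r + toℕ (next m c)) % m      ≡⟨ cong (λ x → (toℕ r + x) % m) (toℕ-fromℕ< _) ⟩
    (toℕ r + suc (toℕ c) % m) % m     ≡⟨ %-absorbʳ (toℕ r) (suc (toℕ c)) ⟩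
    (toℕ r + suc (toℕ c)) % m         ≡⟨ toℕ-nextⁿ (suc (toℕ c)) r ⟨
    toℕ (nextⁿ (suc (toℕ c)) r)       ∎)

  nextⁿ-toℕ-zero : ∀ c → nextⁿ (toℕ c) zero ≡ c
  nextⁿ-toℕ-zero c = toℕ-injective (trans (toℕ-nextⁿ (toℕ c) zero) (m<n⇒m%n≡m (toℕ<n c)))

  nextⁿ-surjective : ∀ r₀ r → ∃ λ c → nextⁿ (toℕ c) r₀ ≡ r
  nextⁿ-surjective r₀ r = c , toℕ-injective (begin
    toℕ (nextⁿ (toℕ c) r₀)   ≡⟨ toℕ-nextⁿ (toℕ c) r₀ ⟩
    (toℕ r₀ + toℕ c) % m     ≡⟨ cong (λ x → (toℕ r₀ + x) % m) (toℕ-fromℕ< (m%n<n j m)) ⟩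
    (toℕ r₀ + j % m) % m     ≡⟨ %-absorbʳ (toℕ r₀) j ⟩
    (toℕ r₀ + j) % m         ≡⟨ cong (_% m) r₀+j≡r+m ⟩
    (toℕ r + m) % m          ≡⟨ [m+n]%n≡m%n (toℕ r) m ⟩
    toℕ r % m                ≡⟨ m<n⇒m%n≡m (toℕ<n r) ⟩
    toℕ r                    ∎)
    where
    j = toℕ r + (m ∸ toℕ r₀)
    c = j mod m
    r₀+j≡r+m : toℕ r₀ + j ≡ toℕ r + m
    r₀+j≡r+m = begin
      toℕ r₀ + (toℕ r + (m ∸ toℕ r₀)) ≡⟨ +-assoc (toℕ r₀) (toℕ r) _ ⟨
      toℕ r₀ + toℕ r + (m ∸ toℕ r₀)   ≡⟨ cong (_+ (m ∸ toℕ r₀)) (+-comm (toℕ r₀) (toℕ r)) ⟩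
      toℕ r + toℕ r₀ + (m ∸ toℕ r₀)   ≡⟨ +-assoc (toℕ r) (toℕ r₀) _ ⟩
      toℕ r + (toℕ r₀ + (m ∸ toℕ r₀)) ≡⟨ cong (toℕ r +_) (m+[n∸m]≡n (<⇒≤ (toℕ<n r₀))) ⟩
      toℕ r + m                       ∎

  rot : ∀ {k} → Label k m → Fin m → Label k m
  rot nothing c = nothing
  rot (just (l , r)) c = just (l , nextⁿ (toℕ c) r)

  rot-zero : ∀ {k} (y : Label k m) → y ≡ rot y zero
  rot-zero nothing = refl
  rot-zero (just _) = refl

  rot-next : ∀ {k} (y : Label k m) c → rot y (next m c) ≡ shift m (rot y c)
  rot-next nothing c = refl
  rot-next (just (l , r)) c = cong (λ r′ → just (l , r′)) (nextⁿ-next c r)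

  equivariant⇒rot : ∀ {k} (h : Fin m → Label k m) → (∀ c → h (next m c) ≡ shift m (h c)) →
    ∀ c → h c ≡ rot (h zero) c
  equivariant⇒rot h h-next c = subst (λ c → h c ≡ rot (h zero) c) (nextⁿ-toℕ-zero c) (along (toℕ c))
    where
    along : ∀ j → h (nextⁿ j zero) ≡ rot (h zero) (nextⁿ j zero)
    along zero = rot-zero (h zero)
    along (suc j) = begin
      h (next m (nextⁿ j zero))               ≡⟨ h-next _ ⟩
      shift m (h (nextⁿ j zero))              ≡⟨ cong (shift m) (along j) ⟩
      shift m (rot (h zero) (nextⁿ j zero))   ≡⟨ rot-next (h zero) _ ⟨
      rot (h zero) (next m (nextⁿ j zero))    ∎

module Standardness (m′ : ℕ) where
  open Colours m′ public
  open SumUpTo +-0-commutativeMonoid using (sumUpTo; sumUpTo-blocks)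
  open Nat using (_+_; _*_)
  open import Data.Nat.Properties
    using ( +-identityʳ; <⇒≤; <-irrefl; <-asym; ≤-pred; ≮⇒≥; <-≤-trans; ≤-refl; ≤-trans; ≤-antisym
          ; +-monoʳ-≤; +-monoˡ-≤; *-monoˡ-≤)

  rowEquivariantᵇ : ∀ {k} → (Fin m → Label k m) → Bool
  rowEquivariantᵇ h = allB λ c → labEq (h (next m c)) (shift m (h c))

  increasingᵇ : ∀ {k} → (Fin k → ℕ) → Bool
  increasingᵇ μ = allB λ l → allB λ l′ → not (toℕ l <ᵇ toℕ l′) ∨ (μ l <ᵇ μ l′)

  open ≡-Reasoning

  module _ {n k : ℕ} where

    equivariantᵇ : Assign n m k → Bool
    equivariantᵇ g = allB λ i → rowEquivariantᵇ (g i)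

    hitsᵇ : Assign n m k → Fin k → Fin m → Fin n → Bool
    hitsᵇ g l r i = anyB λ c → labEq (g i c) (just (l , r))

    coveringᵇ : Assign n m k → Bool
    coveringᵇ g = allB λ l → allB λ r → anyB (hitsᵇ g l r)

    anchorsᵇ : Assign n m k → (Fin k → ℕ) → Fin k → Fin m → Fin n → Bool
    anchorsᵇ g μ l r i = (toℕ i ≡ᵇ μ l) ∧ labEq (g i r) (just (l , r))

    anchoredᵇ : Assign n m k → (Fin k → ℕ) → Bool
    anchoredᵇ g μ = allB λ l → allB λ r → anyB (anchorsᵇ g μ l r)

    meetsᵇ : Assign n m k → Fin k → Fin n → Bool
    meetsᵇ g l i = anyB λ c → inGroup l (g i c)

    occursᵇ : Assign n m k → Fin k → Bool
    occursᵇ g l = anyB (meetsᵇ g l)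

    group-inv : Assign n m k → (Fin k → ℕ) → Fin n → Fin k → ℕ
    group-inv g μ i l = countB λ r → b2n ((idx m (g i zero) <ᵇ idx m (just (l , r))) ∧ not (toℕ i <ᵇ μ l))

    row-inv : Assign n m k → (Fin k → ℕ) → Fin n → ℕ
    row-inv g μ i = countB (group-inv g μ i)

    standardᵇ : Assign n m k → Bool
    standardᵇ = isStandardCSP n m k

    Full : Assign n m k → Set
    Full g = ∀ l → occursᵇ g l ≡ true

    record Standard (g : Assign n m k) : Set where
      field
        equivariant : equivariantᵇ g ≡ true
        covering    : coveringᵇ g ≡ true
        increasing  : increasingᵇ (minb g) ≡ true
        anchored    : anchoredᵇ g (minb g) ≡ true

    standard⁻ : (g : Assign n m k) → standardᵇ g ≡ true → Standard g
    standard⁻ g s = record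
      { equivariant = ∧-conicalˡ (equivariantᵇ g) _ s
      ; covering    = ∧-conicalˡ (coveringᵇ g) _ s₂
      ; increasing  = ∧-conicalˡ (increasingᵇ (minb g)) _ s₃
      ; anchored    = ∧-conicalʳ (increasingᵇ (minb g)) _ s₃
      }
      where
      s₂ = ∧-conicalʳ (equivariantᵇ g) _ s
      s₃ = ∧-conicalʳ (coveringᵇ g) _ s₂

    standard⁺ : (g : Assign n m k) → Standard g → standardᵇ g ≡ true
    standard⁺ g s = cong₂ _∧_ equivariant (cong₂ _∧_ covering (cong₂ _∧_ increasing anchored))
      where open Standard s

  inGroup-rot : ∀ {k} (l : Fin k) y c → inGroup l (rot y c) ≡ inGroup l y
  inGroup-rot l nothing c = refl
  inGroup-rot l (just _) c = refl

  inGroup-true⁻ : ∀ {k} (l : Fin k) (y : Label k m) → inGroup l y ≡ true → ∃ λ r → y ≡ just (l , r)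
  inGroup-true⁻ l (just (l′ , r)) h = r , cong (λ l → just (l , r)) (sym (finEq-true⁻ l l′ h))

  rowEquivariant⁻ : ∀ {k} (h : Fin m → Label k m) → rowEquivariantᵇ h ≡ true → ∀ c → h c ≡ rot (h zero) c
  rowEquivariant⁻ h eq = equivariant⇒rot h λ c → labEq-true⁻ _ _ (allB-true⁻ _ eq c)

  rowEquivariant-rot : ∀ {k} (y : Label k m) → rowEquivariantᵇ (rot y) ≡ true
  rowEquivariant-rot y = allB-true⁺ _ λ c → labEq-≡ (rot-next y c)

  increasing⁻ : ∀ {k} {μ : Fin k → ℕ} → increasingᵇ μ ≡ true → ∀ l l′ → toℕ l < toℕ l′ → μ l < μ l′
  increasing⁻ {μ = μ} inc l l′ l<l′ = <ᵇ⇒< (μ l) (μ l′) (≡true⇒T (begin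
    μ l <ᵇ μ l′                                 ≡⟨⟩
    not true ∨ (μ l <ᵇ μ l′)                    ≡⟨ cong (λ b → not b ∨ (μ l <ᵇ μ l′)) (T⇒≡true (<⇒<ᵇ l<l′)) ⟨
    not (toℕ l <ᵇ toℕ l′) ∨ (μ l <ᵇ μ l′)       ≡⟨ allB-true⁻ _ (allB-true⁻ _ inc l) l′ ⟩
    true                                        ∎))

  group-unique : ∀ {k} {y : Label k m} {l l′ r r′} → y ≡ just (l , r) → y ≡ just (l′ , r′) → l ≡ l′
  group-unique refl refl = refl

  module _ {n k : ℕ} where

    covering⁻ : (g : Assign n m k) → coveringᵇ g ≡ true → ∀ l r → ∃ λ i → ∃ λ c → g i c ≡ just (l , r)
    covering⁻ g cov l r =
      let i , meets = anyB-true⁻ _ (allB-true⁻ _ (allB-true⁻ _ cov l) r)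
          c , hit = anyB-true⁻ _ meets
      in i , c , labEq-true⁻ _ _ hit

    covering⁺ : (g : Assign n m k) → (∀ l r → ∃ λ i → ∃ λ c → g i c ≡ just (l , r)) → coveringᵇ g ≡ true
    covering⁺ g cov = allB-true⁺ _ λ l → allB-true⁺ _ λ r →
      let i , c , hit = cov l r in anyB-true⁺ _ i (anyB-true⁺ _ c (labEq-≡ hit))

    anchored⁻ : (g : Assign n m k) (μ : Fin k → ℕ) → anchoredᵇ g μ ≡ true →
      ∀ l r → ∃ λ i → toℕ i ≡ μ l × g i r ≡ just (l , r)
    anchored⁻ g μ anc l r =
      let i , hit = anyB-true⁻ _ (allB-true⁻ _ (allB-true⁻ _ anc l) r)
      in i , ≡ᵇ⇒≡ _ _ (≡true⇒T (∧-conicalˡ _ _ hit)) , labEq-true⁻ _ _ (∧-conicalʳ _ _ hit)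

    occurs⁺ : (g : Assign n m k) {l : Fin k} {r : Fin m} (i : Fin n) (c : Fin m) →
      g i c ≡ just (l , r) → occursᵇ g l ≡ true
    occurs⁺ g {l} i c hit = anyB-true⁺ _ i (anyB-true⁺ _ c (trans (cong (inGroup l) hit) (finEq-refl l)))

    minb-< : (g : Assign n m k) (l : Fin k) → occursᵇ g l ≡ true → minb g l < n
    minb-< g l occ = let i , meets = anyB-true⁻ _ occ in leastℕ-< _ i meets

    covering⇒full : (g : Assign n m k) → coveringᵇ g ≡ true → Full g
    covering⇒full g cov l = let i , c , hit = covering⁻ g cov l zero in occurs⁺ g i c hit

    equivariant∧full⇒covering : (g : Assign n m k) → equivariantᵇ g ≡ true → Full g → coveringᵇ g ≡ true
    equivariant∧full⇒covering g eqv full = covering⁺ g λ l r →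
      let i , meets = anyB-true⁻ _ (full l)
          c , inl = anyB-true⁻ _ meets
          g-rot = rowEquivariant⁻ (g i) (allB-true⁻ _ eqv i)
          r₀ , gi₀ = inGroup-true⁻ l (g i zero) (trans (sym (inGroup-rot l (g i zero) c))
                                                        (trans (cong (inGroup l) (sym (g-rot c))) inl))
          c′ , c′↦r = nextⁿ-surjective r₀ r
      in i , c′ , trans (g-rot c′) (trans (cong (λ y → rot y c′) gi₀) (cong (λ r → just (l , r)) c′↦r))

  increasingᵇ-cong : ∀ {k} {μ μ′ : Fin k → ℕ} → (∀ l → μ l ≡ μ′ l) → increasingᵇ μ ≡ increasingᵇ μ′
  increasingᵇ-cong μ≗μ′ = allB-cong λ l → allB-cong λ l′ →
    cong₂ (λ a b → not (toℕ l <ᵇ toℕ l′) ∨ (a <ᵇ b)) (μ≗μ′ l) (μ≗μ′ l′)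

  module _ {n k : ℕ} {g g′ : Assign n m k} (g≗g′ : ∀ i c → g i c ≡ g′ i c) where

    minb-cong : ∀ l → minb g l ≡ minb g′ l
    minb-cong l = leastℕ-cong λ i → anyB-cong λ c → cong (inGroup l) (g≗g′ i c)

    standardᵇ-cong : standardᵇ g ≡ standardᵇ g′
    standardᵇ-cong = cong₂ _∧_
      (allB-cong λ i → allB-cong λ c → cong₂ labEq (g≗g′ i (next m c)) (cong (shift m) (g≗g′ i c)))
      (cong₂ _∧_
        (allB-cong λ l → allB-cong λ r → anyB-cong λ i → anyB-cong λ c → cong (λ y → labEq y (just (l , r))) (g≗g′ i c))
        (cong₂ _∧_
          (increasingᵇ-cong minb-cong)
          (allB-cong λ l → allB-cong λ r → anyB-cong λ i →
            cong₂ (λ μl y → (toℕ i ≡ᵇ μl) ∧ labEq y (just (l , r))) (minb-cong l) (g≗g′ i r))))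

    inv-cong : inv n m k g ≡ inv n m k g′
    inv-cong = countB-cong λ i → countB-cong λ l → countB-cong λ r →
      cong₂ (λ y μl → b2n ((idx m y <ᵇ idx m (just (l , r))) ∧ not (toℕ i <ᵇ μl))) (g≗g′ i zero) (minb-cong l)

  blocksAbove : ℕ → ℕ → ℕ
  blocksAbove k j = countB {k} λ l → countB λ r → b2n (j <ᵇ idx m (just (l , r)))

  count-above : ∀ j N → sumUpTo N (λ s → b2n (j <ᵇ suc s)) ≡ N ∸ j
  count-above zero zero = refl
  count-above zero (suc N) = cong suc (count-above zero N)
  count-above (suc j) zero = refl
  count-above (suc j) (suc N) = count-above j N

  blocksAbove-eq : ∀ k j → blocksAbove k j ≡ k * m ∸ j
  blocksAbove-eq k j = begin
    blocksAbove k j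
      ≡⟨ +-Fold.foldAll≡sum (countB ∘ above) ⟩
    +-Fold.sum {k} (countB ∘ above)
      ≡⟨ +-Fold.sum-cong-≗ {k} (+-Fold.foldAll≡sum ∘ above) ⟩
    +-Fold.sum {k} (λ l → +-Fold.sum {m} (above l))
      ≡⟨ sumUpTo-blocks m′ k (λ x → b2n (j <ᵇ x)) ⟩
    sumUpTo (k * m) (λ s → b2n (j <ᵇ suc s))
      ≡⟨ count-above j (k * m) ⟩
    k * m ∸ j ∎
    where
    above : Fin k → Fin m → ℕ
    above l r = b2n (j <ᵇ idx m (just (l , r)))

  module Snoc {n k : ℕ} (f : Assign n m k) (h : Fin m → Label k m) where

    g : Assign (suc n) m k
    g = snoc f h

    g-init : ∀ i c → g (inject₁ i) c ≡ f i c
    g-init i c = cong (λ row → row c) (snoc-inject₁ f h i)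

    g-last : ∀ c → g (fromℕ n) c ≡ h c
    g-last c = cong (λ row → row c) (snoc-fromℕ f h)

    equivariantᵇ-snoc : equivariantᵇ g ≡ equivariantᵇ f ∧ rowEquivariantᵇ h
    equivariantᵇ-snoc = trans (allB-init-last (rowEquivariantᵇ ∘ g))
      (cong₂ _∧_ (allB-cong λ i → cong rowEquivariantᵇ (snoc-inject₁ f h i)) (cong rowEquivariantᵇ (snoc-fromℕ f h)))

    meetsᵇ-init : ∀ l i → meetsᵇ g l (inject₁ i) ≡ meetsᵇ f l i
    meetsᵇ-init l i = anyB-cong λ c → cong (inGroup l) (g-init i c)

    minb-snoc-occurs : ∀ l → occursᵇ f l ≡ true → minb g l ≡ minb f l
    minb-snoc-occurs l occ = let i , meets = anyB-true⁻ _ occ in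
      trans (leastℕ-init (meetsᵇ g l) i (trans (meetsᵇ-init l i) meets)) (leastℕ-cong (meetsᵇ-init l))

    minb-snoc-new : ∀ l → occursᵇ f l ≡ false → anyB (λ c → inGroup l (h c)) ≡ true → minb g l ≡ n
    minb-snoc-new l ¬occ h-meets = leastℕ-last (meetsᵇ g l) (λ i → trans (meetsᵇ-init l i) (anyB-false⁻ _ ¬occ i))
      (trans (anyB-cong λ c → cong (inGroup l) (g-last c)) h-meets)

    covering-snoc : coveringᵇ f ≡ true → coveringᵇ g ≡ true
    covering-snoc cov = covering⁺ g λ l r →
      let i , c , hit = covering⁻ f cov l r in inject₁ i , c , trans (g-init i c) hit

    module _ (full : Full f) where

      minb-snoc : ∀ l → minb g l ≡ minb f l
      minb-snoc l = minb-snoc-occurs l (full l)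

      last-not-anchor : ∀ l r → anchorsᵇ g (minb g) l r (fromℕ n) ≡ false
      last-not-anchor l r = cong (_∧ labEq (g (fromℕ n) r) (just (l , r))) (¬T⇒≡false λ n≡minb →
        <-irrefl (sym (trans (sym (toℕ-fromℕ n)) (trans (≡ᵇ⇒≡ _ _ n≡minb) (minb-snoc l))))
                 (minb-< f l (full l)))

      anchoredᵇ-snoc : anchoredᵇ g (minb g) ≡ anchoredᵇ f (minb f)
      anchoredᵇ-snoc = allB-cong λ l → allB-cong λ r → begin
        anyB (anchorsᵇ g (minb g) l r)
          ≡⟨ anyB-init-last (anchorsᵇ g (minb g) l r) ⟩
        anyB (anchorsᵇ g (minb g) l r ∘ inject₁) ∨ anchorsᵇ g (minb g) l r (fromℕ n)
          ≡⟨ cong₂ _∨_ (anyB-cong (init-anchor l r)) (last-not-anchor l r) ⟩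
        anyB (anchorsᵇ f (minb f) l r) ∨ false
          ≡⟨ ∨-identityʳ _ ⟩
        anyB (anchorsᵇ f (minb f) l r) ∎
        where
        init-anchor : ∀ l r i → anchorsᵇ g (minb g) l r (inject₁ i) ≡ anchorsᵇ f (minb f) l r i
        init-anchor l r i = cong₂ (λ b y → b ∧ labEq y (just (l , r)))
          (cong₂ _≡ᵇ_ (toℕ-inject₁ i) (minb-snoc l)) (g-init i r)

      standard-init : equivariantᵇ f ≡ true → standardᵇ g ≡ true → standardᵇ f ≡ true
      standard-init eqv sg = standard⁺ f record
        { equivariant = eqv
        ; covering    = equivariant∧full⇒covering f eqv full
        ; increasing  = trans (sym (increasingᵇ-cong minb-snoc)) increasing
        ; anchored    = trans (sym anchoredᵇ-snoc) anchored
        }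
        where open Standard (standard⁻ g sg)

      n≮minb : ∀ l → (toℕ (fromℕ n) <ᵇ minb g l) ≡ false
      n≮minb l = ¬T⇒≡false λ n<minb → <-asym (subst₂ _<_ (toℕ-fromℕ n) (minb-snoc l) (<ᵇ⇒< _ _ n<minb))
                                               (minb-< f l (full l))

      inv-snoc : inv (suc n) m k g ≡ inv n m k f + blocksAbove k (idx m (h zero))
      inv-snoc = trans (countB-init-last (row-inv g (minb g))) (cong₂ _+_ (countB-cong row-init) row-last)
        where
        row-init : ∀ i → row-inv g (minb g) (inject₁ i) ≡ row-inv f (minb f) i
        row-init i = countB-cong λ l → countB-cong λ r →
          cong₂ (λ y b → b2n ((idx m y <ᵇ idx m (just (l , r))) ∧ not b))
                (g-init i zero) (cong₂ _<ᵇ_ (toℕ-inject₁ i) (minb-snoc l))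
        row-last : row-inv g (minb g) (fromℕ n) ≡ blocksAbove k (idx m (h zero))
        row-last = countB-cong λ l → countB-cong λ r →
          trans (cong₂ (λ y b → b2n ((idx m y <ᵇ idx m (just (l , r))) ∧ not b)) (g-last zero) (n≮minb l))
                (cong b2n (∧-identityʳ _))

    standard-snoc : standardᵇ f ≡ true → rowEquivariantᵇ h ≡ true → standardᵇ g ≡ true
    standard-snoc sf eqv-h = standard⁺ g record
      { equivariant = trans equivariantᵇ-snoc (cong₂ _∧_ equivariant eqv-h)
      ; covering    = covering-snoc covering
      ; increasing  = trans (increasingᵇ-cong (minb-snoc full)) increasing
      ; anchored    = trans (anchoredᵇ-snoc full) anchored
      }
      where
      open Standard (standard⁻ f sf)
      full = covering⇒full f covering

    module _ (sg : standardᵇ g ≡ true) where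
      open Standard (standard⁻ g sg)

      h-rot : ∀ c → h c ≡ rot (h zero) c
      h-rot = rowEquivariant⁻ h (∧-conicalʳ (equivariantᵇ f) _ (trans (sym equivariantᵇ-snoc) equivariant))

      missing⇒in-h : ∀ l → occursᵇ f l ≡ false → ∃ λ r → h zero ≡ just (l , r)
      missing⇒in-h l ¬occ with covering⁻ g covering l zero
      ... | i , c , hit with initOrLast i
      ...   | init j = contradictionᵇ (occurs⁺ f j c (trans (sym (g-init j c)) hit)) ¬occ
      ...   | last = inGroup-true⁻ l (h zero) (begin
        inGroup l (h zero)          ≡⟨ inGroup-rot l (h zero) c ⟨
        inGroup l (rot (h zero) c)  ≡⟨ cong (inGroup l) (h-rot c) ⟨
        inGroup l (h c)             ≡⟨ cong (inGroup l) (trans (sym (g-last c)) hit) ⟩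
        finEq l l                   ≡⟨ finEq-refl l ⟩
        true                        ∎)

      some-missing : standardᵇ f ≡ false → ∃ λ l₀ → occursᵇ f l₀ ≡ false
      some-missing ¬sf with allB (occursᵇ f) in all-occur
      ... | false = allB-false⁻ _ all-occur
      ... | true = contradictionᵇ (standard-init (allB-true⁻ _ all-occur) eqv-f sg) ¬sf
        where eqv-f = ∧-conicalˡ (equivariantᵇ f) _ (trans (sym equivariantᵇ-snoc) equivariant)

      opens-new-group : standardᵇ f ≡ false →
        ∃ λ l₀ → h zero ≡ just (l₀ , zero) × occursᵇ f l₀ ≡ false × (∀ l → toℕ l ≤ toℕ l₀)
      opens-new-group ¬sf = l₀ , h₀≡l₀0 , l₀-missing , maximal
        where
        l₀ = proj₁ (some-missing ¬sf)
        l₀-missing = proj₂ (some-missing ¬sf)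
        h₀≡l₀r₀ = proj₂ (missing⇒in-h l₀ l₀-missing)

        others-occur : ∀ l → toℕ l₀ < toℕ l → occursᵇ f l ≡ true
        others-occur l l₀<l with occursᵇ f l in occ
        ... | true = refl
        ... | false = ⊥-elim (<-irrefl (cong toℕ (group-unique h₀≡l₀r₀ (proj₂ (missing⇒in-h l occ)))) l₀<l)

        minb-l₀ : minb g l₀ ≡ n
        minb-l₀ = minb-snoc-new l₀ l₀-missing
          (anyB-true⁺ (inGroup l₀ ∘ h) zero (trans (cong (inGroup l₀) h₀≡l₀r₀) (finEq-refl l₀)))

        h₀≡l₀0 : h zero ≡ just (l₀ , zero)
        h₀≡l₀0 = let i , i≡minb , gi₀ = anchored⁻ g (minb g) anchored l₀ zero
                     i≡last = toℕ-injective (trans i≡minb (trans minb-l₀ (sym (toℕ-fromℕ n))))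
                 in trans (sym (g-last zero)) (trans (cong (λ i → g i zero) (sym i≡last)) gi₀)

        maximal : ∀ l → toℕ l ≤ toℕ l₀
        maximal l = ≮⇒≥ λ l₀<l → <-asym
          (subst (_< minb g l) minb-l₀ (increasing⁻ increasing l₀ l l₀<l))
          (subst (_< n) (sym (minb-snoc-occurs l (others-occur l l₀<l))) (minb-< f l (others-occur l l₀<l)))

  module _ {k′ : ℕ} where

    embed : Label k′ m → Label (suc k′) m
    embed nothing = nothing
    embed (just (l , r)) = just (inject₁ l , r)

    lastGroupᵇ : Label (suc k′) m → Bool
    lastGroupᵇ = inGroup (fromℕ k′)

    opener : Label (suc k′) m
    opener = just (fromℕ k′ , zero)

    avoidsLastᵇ : ∀ {n} → Assign n m (suc k′) → Bool
    avoidsLastᵇ f = allB λ i → allB λ c → not (lastGroupᵇ (f i c))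

    finEq-inject₁ : (l l′ : Fin k′) → finEq (inject₁ l) (inject₁ l′) ≡ finEq l l′
    finEq-inject₁ l l′ = cong₂ _≡ᵇ_ (toℕ-inject₁ l) (toℕ-inject₁ l′)

    finEq-fromℕ-inject₁ : (l : Fin k′) → finEq (fromℕ k′) (inject₁ l) ≡ false
    finEq-fromℕ-inject₁ l = ¬T⇒≡false λ eq →
      toℕ-inject₁-≢ l (trans (sym (toℕ-fromℕ k′)) (≡ᵇ⇒≡ _ _ eq))

    labEq-embed : (a b : Label k′ m) → labEq (embed a) (embed b) ≡ labEq a b
    labEq-embed nothing nothing = refl
    labEq-embed nothing (just _) = refl
    labEq-embed (just _) nothing = refl
    labEq-embed (just (l , r)) (just (l′ , r′)) = cong (_∧ finEq r r′) (finEq-inject₁ l l′)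

    shift-embed : (a : Label k′ m) → shift m (embed a) ≡ embed (shift m a)
    shift-embed nothing = refl
    shift-embed (just _) = refl

    inGroup-embed : (l : Fin k′) (a : Label k′ m) → inGroup (inject₁ l) (embed a) ≡ inGroup l a
    inGroup-embed l nothing = refl
    inGroup-embed l (just (l′ , _)) = finEq-inject₁ l l′

    lastGroup-embed : (a : Label k′ m) → lastGroupᵇ (embed a) ≡ false
    lastGroup-embed nothing = refl
    lastGroup-embed (just (l , _)) = finEq-fromℕ-inject₁ l

    idx-embed : (a : Label k′ m) → idx m (embed a) ≡ idx m a
    idx-embed nothing = refl
    idx-embed (just (l , r)) = cong (λ x → x * m + (if toℕ r ≡ᵇ 0 then m else toℕ r)) (toℕ-inject₁ l)

    maximal⇒fromℕ : (l₀ : Fin (suc k′)) → (∀ l → toℕ l ≤ toℕ l₀) → l₀ ≡ fromℕ k′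
    maximal⇒fromℕ l₀ maximal = toℕ-injective (trans
      (≤-antisym (≤-pred (toℕ<n l₀)) (subst (_≤ toℕ l₀) (toℕ-fromℕ k′) (maximal (fromℕ k′))))
      (sym (toℕ-fromℕ k′)))

    rot-opener : ∀ r → rot opener r ≡ just (fromℕ k′ , r)
    rot-opener r = cong (λ r′ → just (fromℕ k′ , r′)) (nextⁿ-toℕ-zero r)

    avoids⇒¬standard : ∀ {n} (f : Assign n m (suc k′)) → avoidsLastᵇ f ≡ true → standardᵇ f ≡ false
    avoids⇒¬standard f av with standardᵇ f in sf
    ... | false = refl
    ... | true = let i , c , hit = covering⁻ f (Standard.covering (standard⁻ f sf)) (fromℕ k′) zero in
      contradictionᵇ (allB-true⁻ _ (allB-true⁻ _ av i) c)
                     (trans (cong (not ∘ lastGroupᵇ) hit) (cong not (finEq-refl (fromℕ k′))))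

    missing⇒avoids : ∀ {n} (f : Assign n m (suc k′)) → occursᵇ f (fromℕ k′) ≡ false → avoidsLastᵇ f ≡ true
    missing⇒avoids f ¬occ = allB-true⁺ _ λ i → allB-true⁺ _ λ c →
      cong not (anyB-false⁻ (lastGroupᵇ ∘ f i) (anyB-false⁻ (meetsᵇ f (fromℕ k′)) ¬occ i) c)

    idx-≤-opener : ∀ (l : Fin (suc k′)) (r : Fin m) → idx m (just (l , r)) ≤ idx m opener
    idx-≤-opener l r = ≤-trans (idx-≤-block r) (+-monoˡ-≤ m (*-monoˡ-≤ m (subst (toℕ l ≤_) (sym (toℕ-fromℕ k′)) (≤-pred (toℕ<n l)))))
      where
      idx-≤-block : ∀ r → idx m (just (l , r)) ≤ toℕ l * m + m
      idx-≤-block zero = ≤-refl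
      idx-≤-block (suc r) = +-monoʳ-≤ (toℕ l * m) (<⇒≤ (s≤s (toℕ<n r)))

    module NewGroup {n : ℕ} (f′ : Assign n m k′) where

      f : Assign n m (suc k′)
      f i c = embed (f′ i c)

      open Snoc f (rot opener) public

      equivariantᵇ-new : equivariantᵇ g ≡ equivariantᵇ f′
      equivariantᵇ-new = trans equivariantᵇ-snoc (trans (cong₂ _∧_ eqv-f (rowEquivariant-rot opener)) (∧-identityʳ _))
        where
        eqv-f : equivariantᵇ f ≡ equivariantᵇ f′
        eqv-f = allB-cong λ i → allB-cong λ c →
          trans (cong (labEq (f i (next m c))) (shift-embed (f′ i c))) (labEq-embed (f′ i (next m c)) (shift m (f′ i c)))

      hitsᵇ-old : ∀ l r → anyB (hitsᵇ g (inject₁ l) r) ≡ anyB (hitsᵇ f′ l r)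
      hitsᵇ-old l r = begin
        anyB (hitsᵇ g (inject₁ l) r)
          ≡⟨ anyB-init-last (hitsᵇ g (inject₁ l) r) ⟩
        anyB (hitsᵇ g (inject₁ l) r ∘ inject₁) ∨ hitsᵇ g (inject₁ l) r (fromℕ n)
          ≡⟨ cong₂ _∨_ (anyB-cong λ i → anyB-cong λ c → old-hit i c) (anyB-false⁺ _ new-miss) ⟩
        anyB (hitsᵇ f′ l r) ∨ false
          ≡⟨ ∨-identityʳ _ ⟩
        anyB (hitsᵇ f′ l r) ∎
        where
        old-hit : ∀ i c → labEq (g (inject₁ i) c) (just (inject₁ l , r)) ≡ labEq (f′ i c) (just (l , r))
        old-hit i c = trans (cong (λ y → labEq y (just (inject₁ l , r))) (g-init i c)) (labEq-embed (f′ i c) (just (l , r)))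
        new-miss : ∀ c → labEq (g (fromℕ n) c) (just (inject₁ l , r)) ≡ false
        new-miss c = trans (cong (λ y → labEq y (just (inject₁ l , r))) (trans (g-last c) (rot-opener c)))
                           (cong (_∧ finEq c r) (finEq-fromℕ-inject₁ l))

      coveringᵇ-new : coveringᵇ g ≡ coveringᵇ f′
      coveringᵇ-new = trans (allB-init-last (λ l → allB λ r → anyB (hitsᵇ g l r)))
        (trans (cong₂ _∧_ (allB-cong λ l → allB-cong (hitsᵇ-old l)) new-covered) (∧-identityʳ _))
        where
        new-covered : allB (λ r → anyB (hitsᵇ g (fromℕ k′) r)) ≡ true
        new-covered = allB-true⁺ _ λ r → anyB-true⁺ _ (fromℕ n)
          (anyB-true⁺ (λ c → labEq (g (fromℕ n) c) (just (fromℕ k′ , r))) r (labEq-≡ (trans (g-last r) (rot-opener r))))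

      module _ (full : Full f′) where

        meets-old : ∀ l i → meetsᵇ f (inject₁ l) i ≡ meetsᵇ f′ l i
        meets-old l i = anyB-cong λ c → inGroup-embed l (f′ i c)

        minb-old : ∀ l → minb g (inject₁ l) ≡ minb f′ l
        minb-old l = trans (minb-snoc-occurs (inject₁ l) (trans (anyB-cong (meets-old l)) (full l)))
                           (leastℕ-cong (meets-old l))

        minb-new : minb g (fromℕ k′) ≡ n
        minb-new = minb-snoc-new (fromℕ k′)
          (anyB-false⁺ _ λ i → anyB-false⁺ (lastGroupᵇ ∘ f i) λ c → lastGroup-embed (f′ i c))
          (anyB-true⁺ (lastGroupᵇ ∘ rot opener) zero (finEq-refl (fromℕ k′)))

        increasingᵇ-new : increasingᵇ (minb g) ≡ increasingᵇ (minb f′)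
        increasingᵇ-new = begin
          allB (λ l → allB (ordered l))
            ≡⟨ allB-init-last (λ l → allB (ordered l)) ⟩
          allB (λ l → allB (ordered (inject₁ l))) ∧ allB (ordered (fromℕ k′))
            ≡⟨ cong₂ _∧_ (allB-cong old-row) (allB-true⁺ _ new-row) ⟩
          increasingᵇ (minb f′) ∧ true
            ≡⟨ ∧-identityʳ _ ⟩
          increasingᵇ (minb f′) ∎
          where
          ordered : Fin (suc k′) → Fin (suc k′) → Bool
          ordered l l′ = not (toℕ l <ᵇ toℕ l′) ∨ (minb g l <ᵇ minb g l′)
          old-row : ∀ l → allB (ordered (inject₁ l)) ≡ allB λ l′ → not (toℕ l <ᵇ toℕ l′) ∨ (minb f′ l <ᵇ minb f′ l′)
          old-row l = trans (allB-init-last (ordered (inject₁ l)))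
            (trans (cong₂ _∧_ (allB-cong old-pair) new-pair) (∧-identityʳ _))
            where
            old-pair : ∀ l′ → ordered (inject₁ l) (inject₁ l′) ≡ (not (toℕ l <ᵇ toℕ l′) ∨ (minb f′ l <ᵇ minb f′ l′))
            old-pair l′ = cong₂ (λ a b → not a ∨ b) (cong₂ _<ᵇ_ (toℕ-inject₁ l) (toℕ-inject₁ l′))
                                                    (cong₂ _<ᵇ_ (minb-old l) (minb-old l′))
            new-pair : ordered (inject₁ l) (fromℕ k′) ≡ true
            new-pair = trans (cong (not (toℕ (inject₁ l) <ᵇ toℕ (fromℕ k′)) ∨_)
                                   (trans (cong₂ _<ᵇ_ (minb-old l) minb-new) (T⇒≡true (<⇒<ᵇ (minb-< f′ l (full l))))))
                             (∨-zeroʳ _)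
          new-row : ∀ l′ → ordered (fromℕ k′) l′ ≡ true
          new-row l′ = cong (λ b → not b ∨ (minb g (fromℕ k′) <ᵇ minb g l′)) (¬T⇒≡false λ k′<l′ →
            <-irrefl refl (<-≤-trans (subst (_< toℕ l′) (toℕ-fromℕ k′) (<ᵇ⇒< _ _ k′<l′)) (≤-pred (toℕ<n l′))))

        anchoredᵇ-new : anchoredᵇ g (minb g) ≡ anchoredᵇ f′ (minb f′)
        anchoredᵇ-new = trans (allB-init-last (λ l → allB λ r → anyB (anchorsᵇ g (minb g) l r)))
          (trans (cong₂ _∧_ (allB-cong λ l → allB-cong (old-anchored l)) (allB-true⁺ _ new-anchored)) (∧-identityʳ _))
          where
          old-anchored : ∀ l r → anyB (anchorsᵇ g (minb g) (inject₁ l) r) ≡ anyB (anchorsᵇ f′ (minb f′) l r)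
          old-anchored l r = trans (anyB-init-last (anchorsᵇ g (minb g) (inject₁ l) r))
            (trans (cong₂ _∨_ (anyB-cong old-row) new-row) (∨-identityʳ _))
            where
            old-row : ∀ i → anchorsᵇ g (minb g) (inject₁ l) r (inject₁ i) ≡ anchorsᵇ f′ (minb f′) l r i
            old-row i = cong₂ _∧_ (cong₂ _≡ᵇ_ (toℕ-inject₁ i) (minb-old l))
              (trans (cong (λ y → labEq y (just (inject₁ l , r))) (g-init i r)) (labEq-embed (f′ i r) (just (l , r))))
            new-row : anchorsᵇ g (minb g) (inject₁ l) r (fromℕ n) ≡ false
            new-row = trans (cong ((toℕ (fromℕ n) ≡ᵇ minb g (inject₁ l)) ∧_)
                              (trans (cong (λ y → labEq y (just (inject₁ l , r))) (trans (g-last r) (rot-opener r)))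
                                     (cong (_∧ finEq r r) (finEq-fromℕ-inject₁ l))))
                            (∧-zeroʳ _)
          new-anchored : ∀ r → anyB (anchorsᵇ g (minb g) (fromℕ k′) r) ≡ true
          new-anchored r = anyB-true⁺ _ (fromℕ n) (cong₂ _∧_
            (trans (cong₂ _≡ᵇ_ (toℕ-fromℕ n) minb-new) (T⇒≡true (≡⇒≡ᵇ n n refl)))
            (labEq-≡ (trans (g-last r) (rot-opener r))))

        row-inv-old : ∀ i → row-inv g (minb g) (inject₁ i) ≡ row-inv f′ (minb f′) i
        row-inv-old i = trans (countB-init-last (group-inv g (minb g) (inject₁ i)))
          (trans (cong₂ _+_ (countB-cong old-group) new-group) (+-identityʳ _))
          where
          old-group : ∀ l → group-inv g (minb g) (inject₁ i) (inject₁ l) ≡ group-inv f′ (minb f′) i l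
          old-group l = countB-cong λ r → cong₂ (λ a b → b2n (a ∧ not b))
            (cong₂ _<ᵇ_ (trans (cong (idx m) (g-init i zero)) (idx-embed (f′ i zero))) (idx-embed (just (l , r))))
            (cong₂ _<ᵇ_ (toℕ-inject₁ i) (minb-old l))
          i<minb-new : (toℕ (inject₁ i) <ᵇ minb g (fromℕ k′)) ≡ true
          i<minb-new = trans (cong (toℕ (inject₁ i) <ᵇ_) minb-new)
                             (T⇒≡true (<⇒<ᵇ (subst (_< n) (sym (toℕ-inject₁ i)) (toℕ<n i))))
          below : Fin m → Bool
          below r = idx m (g (inject₁ i) zero) <ᵇ idx m (just (fromℕ k′ , r))
          new-group : group-inv g (minb g) (inject₁ i) (fromℕ k′) ≡ 0
          new-group = trans (countB-cong {n = m} λ r →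
                               cong b2n (trans (cong (λ b → below r ∧ not b) i<minb-new) (∧-zeroʳ (below r))))
                            (countB-zero m)

        row-inv-new : row-inv g (minb g) (fromℕ n) ≡ 0
        row-inv-new = trans (countB-cong {n = suc k′} λ l → countB-cong {n = m} λ r →
                               cong (λ b → b2n (b ∧ not (toℕ (fromℕ n) <ᵇ minb g l))) (opener-top l r))
                            (trans (countB-cong {n = suc k′} λ l → countB-zero m) (countB-zero (suc k′)))
          where
          opener-top : ∀ l r → (idx m (g (fromℕ n) zero) <ᵇ idx m (just (l , r))) ≡ false
          opener-top l r = trans (cong (λ y → idx m y <ᵇ idx m (just (l , r))) (trans (g-last zero) (rot-opener zero)))
                                 (¬T⇒≡false λ lt → <-irrefl refl (<-≤-trans (<ᵇ⇒< _ _ lt) (idx-≤-opener l r)))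

        inv-new : inv (suc n) m (suc k′) g ≡ inv n m k′ f′
        inv-new = trans (countB-init-last (row-inv g (minb g)))
          (trans (cong₂ _+_ (countB-cong row-inv-old) row-inv-new) (+-identityʳ _))

      standardᵇ-new : standardᵇ g ≡ standardᵇ f′
      standardᵇ-new = ∧-cong-guarded equivariantᵇ-new coveringᵇ-new λ cov →
        let full = covering⇒full f′ cov in cong₂ _∧_ (increasingᵇ-new full) (anchoredᵇ-new full)

module Sums {c ℓ} (R : CommutativeRing c ℓ) where
  open CommutativeRing R hiding (zero) renaming (refl to ≈-refl; sym to ≈-sym; trans to ≈-trans)
  open QAnalogues R using (sumR; pow; qint)
  open import Algebra.Properties.Semiring.Sum semiring public using (sum)
  open import Algebra.Properties.Semiring.Sum semiring using (sum-replicate-zero; *-distribˡ-sum)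
  open SumUpTo +-commutativeMonoid
  open import Relation.Binary.Reasoning.Setoid setoid
  open import Data.List using (_++_; concatMap; cartesianProduct; filter)
  import Data.Bool as Bool

  ∑ : ∀ {a} {A : Set a} → List A → (A → Carrier) → Carrier
  ∑ xs φ = sumR (map φ xs)

  syntax ∑ xs (λ x → e) = ∑[ x ∈ xs ] e

  when : Bool → Carrier → Carrier
  when b x = if b then x else 0#

  ∑-cong : ∀ {a} {A : Set a} (xs : List A) {φ ψ : A → Carrier} → (∀ x → φ x ≈ ψ x) → ∑ xs φ ≈ ∑ xs ψ
  ∑-cong [] _ = ≈-refl
  ∑-cong (x ∷ xs) φ≈ψ = +-cong (φ≈ψ x) (∑-cong xs φ≈ψ)

  ∑-++ : ∀ {a} {A : Set a} (xs ys : List A) (φ : A → Carrier) → ∑ (xs ++ ys) φ ≈ ∑ xs φ + ∑ ys φ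
  ∑-++ [] ys φ = ≈-sym (+-identityˡ _)
  ∑-++ (x ∷ xs) ys φ = ≈-trans (+-congˡ (∑-++ xs ys φ)) (≈-sym (+-assoc _ _ _))

  ∑-map : ∀ {a b} {A : Set a} {B : Set b} (g : A → B) (xs : List A) (φ : B → Carrier) → ∑ (map g xs) φ ≡ ∑ xs (φ ∘ g)
  ∑-map g [] φ = refl
  ∑-map g (x ∷ xs) φ = cong (φ (g x) +_) (∑-map g xs φ)

  ∑-concatMap : ∀ {a b} {A : Set a} {B : Set b} (G : A → List B) (xs : List A) (φ : B → Carrier) →
    ∑ (concatMap G xs) φ ≈ ∑[ x ∈ xs ] ∑ (G x) φ
  ∑-concatMap G [] φ = ≈-refl
  ∑-concatMap G (x ∷ xs) φ = ≈-trans (∑-++ (G x) (concatMap G xs) φ) (+-congˡ (∑-concatMap G xs φ))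

  ∑-0 : ∀ {a} {A : Set a} (xs : List A) → ∑[ x ∈ xs ] 0# ≈ 0#
  ∑-0 [] = ≈-refl
  ∑-0 (x ∷ xs) = ≈-trans (+-identityˡ _) (∑-0 xs)

  ∑-+ : ∀ {a} {A : Set a} (xs : List A) (φ ψ : A → Carrier) → ∑[ x ∈ xs ] (φ x + ψ x) ≈ ∑ xs φ + ∑ xs ψ
  ∑-+ [] φ ψ = ≈-sym (+-identityˡ _)
  ∑-+ (x ∷ xs) φ ψ = ≈-trans (+-congˡ (∑-+ xs φ ψ)) (interchange (φ x) (ψ x) (∑ xs φ) (∑ xs ψ))
    where open import Algebra.Properties.CommutativeSemigroup +-commutativeSemigroup using (interchange)

  ∑-*ˡ : ∀ {a} {A : Set a} (xs : List A) (u : Carrier) (φ : A → Carrier) → ∑[ x ∈ xs ] (u * φ x) ≈ u * ∑ xs φ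
  ∑-*ˡ [] u φ = ≈-sym (zeroʳ u)
  ∑-*ˡ (x ∷ xs) u φ = ≈-trans (+-congˡ (∑-*ˡ xs u φ)) (≈-sym (distribˡ u _ _))

  ∑-*ʳ : ∀ {a} {A : Set a} (xs : List A) (u : Carrier) (φ : A → Carrier) → ∑[ x ∈ xs ] (φ x * u) ≈ ∑ xs φ * u
  ∑-*ʳ xs u φ = ≈-trans (∑-cong xs λ x → *-comm (φ x) u) (≈-trans (∑-*ˡ xs u φ) (*-comm u _))

  ∑-swap : ∀ {a b} {A : Set a} {B : Set b} (xs : List A) (ys : List B) (G : A → B → Carrier) →
    ∑[ x ∈ xs ] ∑[ y ∈ ys ] G x y ≈ ∑[ y ∈ ys ] ∑[ x ∈ xs ] G x y
  ∑-swap [] ys G = ≈-sym (∑-0 ys)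
  ∑-swap (x ∷ xs) ys G = ≈-trans (+-congˡ (∑-swap xs ys G)) (≈-sym (∑-+ ys (G x) (λ y → ∑[ x ∈ xs ] G x y)))

  ∑-cartesianProduct : ∀ {a b} {A : Set a} {B : Set b} (xs : List A) (ys : List B) (φ : A × B → Carrier) →
    ∑ (cartesianProduct xs ys) φ ≈ ∑[ x ∈ xs ] ∑[ y ∈ ys ] φ (x , y)
  ∑-cartesianProduct [] ys φ = ≈-refl
  ∑-cartesianProduct (x ∷ xs) ys φ =
    ≈-trans (∑-++ (map (x ,_) ys) _ φ) (+-cong (reflexive (∑-map (x ,_) ys φ)) (∑-cartesianProduct xs ys φ))

  ∑-allFin : ∀ {n} (φ : Fin n → Carrier) → ∑ (allFin n) φ ≡ sum φ
  ∑-allFin = FoldOverFin.foldAll≡sum +-monoid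

  ∑-upTo : ∀ N (φ : ℕ → Carrier) → ∑ (upTo N) φ ≡ sum {N} (φ ∘ toℕ)
  ∑-upTo N φ = FoldOverFin.foldr-map-applyUpTo +-monoid φ id N

  ∑-filter : ∀ {a} {A : Set a} (p : A → Bool) (φ : A → Carrier) (xs : List A) →
    ∑ (filter (λ x → p x Bool.≟ true) xs) φ ≈ ∑[ x ∈ xs ] when (p x) (φ x)
  ∑-filter p φ [] = ≈-refl
  ∑-filter p φ (x ∷ xs) with p x
  ... | true = +-congˡ (∑-filter p φ xs)
  ... | false = ≈-trans (∑-filter p φ xs) (≈-sym (+-identityˡ _))

  when-∧ : ∀ a b x → when (a ∧ b) x ≡ when a (when b x)
  when-∧ false b x = refl
  when-∧ true b x = refl

  when-true : ∀ {b} x → b ≡ true → when b x ≡ x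
  when-true x refl = refl

  when-0 : ∀ b → when b 0# ≈ 0#
  when-0 false = ≈-refl
  when-0 true = ≈-refl

  when-cong : ∀ a {x y} → x ≈ y → when a x ≈ when a y
  when-cong false _ = ≈-refl
  when-cong true x≈y = x≈y

  ∑-when : ∀ {a} {A : Set a} (xs : List A) (b : Bool) (φ : A → Carrier) → ∑[ x ∈ xs ] when b (φ x) ≈ when b (∑ xs φ)
  ∑-when xs false φ = ∑-0 xs
  ∑-when xs true φ = ≈-refl

  pow-+ : ∀ x a b → pow x (a Nat.+ b) ≈ pow x a * pow x b
  pow-+ x zero b = ≈-sym (*-identityˡ _)
  pow-+ x (suc a) b = ≈-trans (*-congˡ (pow-+ x a b)) (≈-sym (*-assoc _ _ _))

  qint-+ : ∀ q α β → qint q (α Nat.+ β) ≈ qint q α + pow q α * qint q β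
  qint-+ q α β = begin
    qint q (α Nat.+ β)                                   ≡⟨ ∑-upTo (α Nat.+ β) (pow q) ⟩
    sumUpTo (α Nat.+ β) (pow q)                          ≈⟨ sumUpTo-+ α β (pow q) ⟩
    sumUpTo α (pow q) + sumUpTo β (pow q ∘ (α Nat.+_))   ≈⟨ +-congˡ (sumUpTo-cong β (pow-+ q α)) ⟩
    sumUpTo α (pow q) + sumUpTo β (λ t → pow q α * pow q t) ≈⟨ +-congˡ (*-distribˡ-sum {β} (pow q α) (pow q ∘ toℕ)) ⟨
    sumUpTo α (pow q) + pow q α * sumUpTo β (pow q)      ≡⟨ cong₂ (λ s t → s + pow q α * t) (∑-upTo α (pow q)) (∑-upTo β (pow q)) ⟨
    qint q α + pow q α * qint q β                        ∎

  sum-when : ∀ {n} b (φ : Fin n → Carrier) → sum (λ i → when b (φ i)) ≈ when b (sum φ)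
  sum-when {n} false φ = sum-replicate-zero n
  sum-when true φ = ≈-refl

  sum-delta : ∀ {n} (l₀ : Fin n) (φ : Fin n → Carrier) → sum (λ l → when (finEq l l₀) (φ l)) ≈ φ l₀
  sum-delta {suc n} zero φ = ≈-trans (+-congˡ (sum-replicate-zero n)) (+-identityʳ _)
  sum-delta {suc n} (suc l₀) φ = ≈-trans (+-identityˡ _) (sum-delta l₀ (φ ∘ suc))

  module _ {A : Set} where

    Extensional : ∀ {n} → ((Fin n → A) → Carrier) → Set _
    Extensional G = ∀ f f′ → (∀ i → f i ≡ f′ i) → G f ≈ G f′

    ∑-allFuns-suc : ∀ n (xs : List A) (G : (Fin (suc n) → A) → Carrier) →
      ∑ (allFuns (suc n) xs) G ≈ ∑[ x ∈ xs ] ∑[ t ∈ allFuns n xs ] G (consF x t)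
    ∑-allFuns-suc n xs G = ≈-trans (∑-concatMap (λ x → map (consF x) (allFuns n xs)) xs G)
      (∑-cong xs λ x → reflexive (∑-map (consF x) (allFuns n xs) G))

    ∑-allFuns-snoc : ∀ n (xs : List A) (G : (Fin (suc n) → A) → Carrier) → Extensional G →
      ∑ (allFuns (suc n) xs) G ≈ ∑[ x ∈ xs ] ∑[ f ∈ allFuns n xs ] G (snoc f x)
    ∑-allFuns-snoc zero xs G ext = ≈-trans (∑-allFuns-suc zero xs G)
      (∑-cong xs λ x → +-congʳ (ext _ _ λ { zero → refl }))
    ∑-allFuns-snoc (suc n) xs G ext = begin
      ∑ (allFuns (suc (suc n)) xs) G
        ≈⟨ ∑-allFuns-suc (suc n) xs G ⟩
      ∑[ y ∈ xs ] ∑[ t ∈ allFuns (suc n) xs ] G (consF y t)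
        ≈⟨ ∑-cong xs (λ y → ∑-allFuns-snoc n xs (G ∘ consF y) λ t t′ t≗t′ → ext _ _ λ { zero → refl ; (suc i) → t≗t′ i }) ⟩
      ∑[ y ∈ xs ] ∑[ x ∈ xs ] ∑[ f ∈ allFuns n xs ] G (consF y (snoc f x))
        ≈⟨ ∑-swap xs xs _ ⟩
      ∑[ x ∈ xs ] ∑[ y ∈ xs ] ∑[ f ∈ allFuns n xs ] G (consF y (snoc f x))
        ≈⟨ ∑-cong xs (λ x → ∑-cong xs λ y → ∑-cong (allFuns n xs) λ f → ext _ _ λ { zero → refl ; (suc i) → refl }) ⟩
      ∑[ x ∈ xs ] ∑[ y ∈ xs ] ∑[ f ∈ allFuns n xs ] G (snoc (consF y f) x)
        ≈⟨ ∑-cong xs (λ x → ≈-sym (∑-allFuns-suc n xs (λ f → G (snoc f x)))) ⟩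
      ∑[ x ∈ xs ] ∑[ f ∈ allFuns (suc n) xs ] G (snoc f x) ∎

    ∑-allFuns-when-head : ∀ n (xs : List A) (p : A → Fin (suc n) → Bool) (G : (Fin (suc n) → A) → Carrier) →
      ∑[ f ∈ allFuns (suc n) xs ] when (allB λ i → p (f i) i) (G f)
      ≈ ∑[ x ∈ xs ] when (p x zero) (∑[ t ∈ allFuns n xs ] when (allB λ i → p (t i) (suc i)) (G (consF x t)))
    ∑-allFuns-when-head n xs p G = ≈-trans (∑-allFuns-suc n xs _) (∑-cong xs λ x →
      ≈-trans (∑-cong (allFuns n xs) λ t →
                 reflexive (trans (cong (λ b → when b (G (consF x t))) (allB-head-tail λ i → p (consF x t i) i))
                                  (when-∧ (p x zero) _ _)))
              (∑-when (allFuns n xs) (p x zero) _))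

    ∑-allFuns-delta : (xs : List A) (eq : A → A → Bool) →
      (∀ z (H : A → Carrier) → ∑[ x ∈ xs ] when (eq x z) (H x) ≈ H z) →
      ∀ n (ψ : Fin n → A) (K : (Fin n → A) → Carrier) → Extensional K →
      ∑[ t ∈ allFuns n xs ] when (allB λ i → eq (t i) (ψ i)) (K t) ≈ K ψ
    ∑-allFuns-delta xs eq delta zero ψ K ext = ≈-trans (+-identityʳ _) (ext _ _ λ ())
    ∑-allFuns-delta xs eq delta (suc n) ψ K ext = begin
      ∑[ t ∈ allFuns (suc n) xs ] when (allB λ i → eq (t i) (ψ i)) (K t)
        ≈⟨ ∑-allFuns-when-head n xs (λ x i → eq x (ψ i)) K ⟩
      ∑[ x ∈ xs ] when (eq x (ψ zero)) (∑[ t ∈ allFuns n xs ] when (allB λ i → eq (t i) (ψ (suc i))) (K (consF x t)))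
        ≈⟨ ∑-cong xs (λ x → when-cong (eq x (ψ zero)) (∑-allFuns-delta xs eq delta n (ψ ∘ suc) (K ∘ consF x)
                                 λ t t′ t≗t′ → ext _ _ λ { zero → refl ; (suc i) → t≗t′ i })) ⟩
      ∑[ x ∈ xs ] when (eq x (ψ zero)) (K (consF x (ψ ∘ suc)))
        ≈⟨ delta (ψ zero) (λ x → K (consF x (ψ ∘ suc))) ⟩
      K (consF (ψ zero) (ψ ∘ suc))
        ≈⟨ ext _ _ (λ { zero → refl ; (suc i) → refl }) ⟩
      K ψ ∎

  module _ {A B : Set} (_∼_ : A → A → Set) (∼-refl : ∀ x → x ∼ x)
           (xs : List A) (ys : List B) (e : B → A) (p : A → Bool) where

    Respects∼ : ∀ {n} → ((Fin n → A) → Carrier) → Set _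
    Respects∼ G = ∀ f f′ → (∀ i → f i ∼ f′ i) → G f ≈ G f′

    ∑-allFuns-restrict :
      (∀ (H : A → Carrier) → (∀ x x′ → x ∼ x′ → H x ≈ H x′) → ∑[ x ∈ xs ] when (p x) (H x) ≈ ∑[ y ∈ ys ] H (e y)) →
      ∀ n (G : (Fin n → A) → Carrier) → Respects∼ G →
      ∑[ f ∈ allFuns n xs ] when (allB λ i → p (f i)) (G f) ≈ ∑[ f′ ∈ allFuns n ys ] G (e ∘ f′)
    ∑-allFuns-restrict restrict zero G resp = +-congʳ (resp _ _ λ ())
    ∑-allFuns-restrict restrict (suc n) G resp = begin
      ∑[ f ∈ allFuns (suc n) xs ] when (allB λ i → p (f i)) (G f)
        ≈⟨ ∑-allFuns-when-head n xs (λ x _ → p x) G ⟩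
      ∑[ x ∈ xs ] when (p x) (H x)
        ≈⟨ restrict H (λ x x′ x∼x′ → ∑-cong (allFuns n xs) λ t → when-cong (allB λ i → p (t i))
                         (resp _ _ λ { zero → x∼x′ ; (suc i) → ∼-refl (t i) })) ⟩
      ∑[ y ∈ ys ] H (e y)
        ≈⟨ ∑-cong ys (λ y → ∑-allFuns-restrict restrict n (G ∘ consF (e y))
                              λ t t′ t∼t′ → resp _ _ λ { zero → ∼-refl (e y) ; (suc i) → t∼t′ i }) ⟩
      ∑[ y ∈ ys ] ∑[ t′ ∈ allFuns n ys ] G (consF (e y) (e ∘ t′))
        ≈⟨ ∑-cong ys (λ y → ∑-cong (allFuns n ys) λ t′ → resp _ _ λ { zero → ∼-refl (e y) ; (suc i) → ∼-refl (e (t′ i)) }) ⟩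
      ∑[ y ∈ ys ] ∑[ t′ ∈ allFuns n ys ] G (e ∘ consF y t′)
        ≈⟨ ∑-allFuns-suc n ys (λ f′ → G (e ∘ f′)) ⟨
      ∑[ f′ ∈ allFuns (suc n) ys ] G (e ∘ f′) ∎
      where
      H : A → Carrier
      H x = ∑[ t ∈ allFuns n xs ] when (allB λ i → p (t i)) (G (consF x t))

module LabelSums {c ℓ} (R : CommutativeRing c ℓ) (m′ : ℕ) where
  open CommutativeRing R hiding (zero) renaming (refl to ≈-refl; sym to ≈-sym; trans to ≈-trans)
  open import Algebra.Properties.Semiring.Sum semiring using (sum-replicate-zero; sum-cong-≋; sum-cong-≗; sum-init-last)
  open import Relation.Binary.Reasoning.Setoid setoid
  open import Data.List using (cartesianProduct)
  open QAnalogues R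
  open Sums R
  open Standardness m′
  open SumUpTo +-commutativeMonoid

  ∑-allLabels : ∀ k (φ : Label k m → Carrier) →
    ∑ (allLabels k m) φ ≈ φ nothing + sum λ l → sum λ r → φ (just (l , r))
  ∑-allLabels k φ = +-congˡ (begin
    ∑ (map just (cartesianProduct (allFin k) (allFin m))) φ
      ≡⟨ ∑-map just (cartesianProduct (allFin k) (allFin m)) φ ⟩
    ∑ (cartesianProduct (allFin k) (allFin m)) (φ ∘ just)
      ≈⟨ ∑-cartesianProduct (allFin k) (allFin m) (φ ∘ just) ⟩
    ∑[ l ∈ allFin k ] ∑[ r ∈ allFin m ] φ (just (l , r))
      ≡⟨ ∑-allFin (λ l → ∑[ r ∈ allFin m ] φ (just (l , r))) ⟩
    sum (λ l → ∑[ r ∈ allFin m ] φ (just (l , r)))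
      ≡⟨ sum-cong-≗ {k} (λ l → ∑-allFin (λ r → φ (just (l , r)))) ⟩
    sum (λ l → sum λ r → φ (just (l , r))) ∎)

  ∑-allLabels-delta : ∀ k (z : Label k m) (H : Label k m → Carrier) →
    ∑[ x ∈ allLabels k m ] when (labEq x z) (H x) ≈ H z
  ∑-allLabels-delta k nothing H = ≈-trans (∑-allLabels k _)
    (≈-trans (+-congˡ (≈-trans (sum-cong-≋ {k} λ l → sum-replicate-zero m) (sum-replicate-zero k))) (+-identityʳ _))
  ∑-allLabels-delta k (just (l₀ , r₀)) H = ≈-trans (∑-allLabels k _) (≈-trans (+-identityˡ _)
    (≈-trans (sum-cong-≋ {k} in-group) (sum-delta l₀ (λ l → H (just (l , r₀))))))
    where
    in-group : ∀ l → sum (λ r → when (finEq l l₀ ∧ finEq r r₀) (H (just (l , r)))) ≈ when (finEq l l₀) (H (just (l , r₀)))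
    in-group l = begin
      sum (λ r → when (finEq l l₀ ∧ finEq r r₀) (H (just (l , r))))
        ≡⟨ sum-cong-≗ {m} (λ r → when-∧ (finEq l l₀) (finEq r r₀) (H (just (l , r)))) ⟩
      sum (λ r → when (finEq l l₀) (when (finEq r r₀) (H (just (l , r)))))
        ≈⟨ sum-when (finEq l l₀) (λ r → when (finEq r r₀) (H (just (l , r)))) ⟩
      when (finEq l l₀) (sum λ r → when (finEq r r₀) (H (just (l , r))))
        ≈⟨ when-cong (finEq l l₀) (sum-delta r₀ (λ r → H (just (l , r)))) ⟩
      when (finEq l l₀) (H (just (l , r₀))) ∎

  ∑-allLabels-avoid : ∀ k′ (H : Label (suc k′) m → Carrier) →
    ∑[ x ∈ allLabels (suc k′) m ] when (not (lastGroupᵇ x)) (H x) ≈ ∑[ y ∈ allLabels k′ m ] H (embed y)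
  ∑-allLabels-avoid k′ H = begin
    ∑[ x ∈ allLabels (suc k′) m ] when (not (lastGroupᵇ x)) (H x)
      ≈⟨ ∑-allLabels (suc k′) _ ⟩
    H nothing + sum (λ l → group l)
      ≈⟨ +-congˡ (sum-init-last {k′} group) ⟩
    H nothing + (sum (group ∘ inject₁) + group (fromℕ k′))
      ≈⟨ +-congˡ (+-cong (sum-cong-≋ {k′} old-group) new-group) ⟩
    H nothing + (sum (λ l → sum λ r → H (embed (just (l , r)))) + 0#)
      ≈⟨ +-congˡ (+-identityʳ _) ⟩
    H nothing + sum (λ l → sum λ r → H (embed (just (l , r))))
      ≈⟨ ∑-allLabels k′ (H ∘ embed) ⟨
    ∑[ y ∈ allLabels k′ m ] H (embed y) ∎
    where
    group : Fin (suc k′) → Carrier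
    group l = sum λ r → when (not (lastGroupᵇ (just (l , r)))) (H (just (l , r)))
    old-group : ∀ l → group (inject₁ l) ≈ sum λ r → H (just (inject₁ l , r))
    old-group l = reflexive (sum-cong-≗ {m} λ r → cong (λ b → when (not b) (H (just (inject₁ l , r)))) (finEq-fromℕ-inject₁ l))
    new-group : group (fromℕ k′) ≈ 0#
    new-group = ≈-trans (reflexive (sum-cong-≗ {m} λ r → cong (λ b → when (not b) (H (just (fromℕ k′ , r)))) (finEq-refl (fromℕ k′))))
                        (sum-replicate-zero m)

  ∑-allLabels-blocksAbove : ∀ q k → ∑[ y ∈ allLabels k m ] pow q (blocksAbove k (idx m y)) ≈ qint q (suc (k Nat.* m))
  ∑-allLabels-blocksAbove q k = begin
    ∑[ y ∈ allLabels k m ] pow q (blocksAbove k (idx m y))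
      ≈⟨ ∑-allLabels k _ ⟩
    pow q (blocksAbove k 0) + sum {k} (λ l → sum {m} λ r → pow q (blocksAbove k (idx m (just (l , r)))))
      ≈⟨ +-congˡ (sumUpTo-blocks m′ k (λ x → pow q (blocksAbove k x))) ⟩
    sumUpTo (suc (k Nat.* m)) (λ s → pow q (blocksAbove k s))
      ≈⟨ sumUpTo-cong (suc (k Nat.* m)) (λ s → reflexive (cong (pow q) (blocksAbove-eq k s))) ⟩
    sumUpTo (suc (k Nat.* m)) (λ s → pow q (k Nat.* m ∸ s))
      ≈⟨ sumUpTo-reverse (k Nat.* m) (pow q) ⟩
    sumUpTo (suc (k Nat.* m)) (pow q)
      ≡⟨ ∑-upTo (suc (k Nat.* m)) (pow q) ⟨
    qint q (suc (k Nat.* m)) ∎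

module Recurrence {c ℓ} (R : CommutativeRing c ℓ) (q : CommutativeRing.Carrier R) (m′ : ℕ) where
  open CommutativeRing R hiding (zero) renaming (refl to ≈-refl; sym to ≈-sym; trans to ≈-trans)
  open import Data.Nat.Properties using (m≤n⇒m≤1+n)
  open import Relation.Nullary using (yes; no)
  open import Data.Bool using (_≟_)
  open import Relation.Binary.Reasoning.Setoid setoid
  open QAnalogues R
  open Sums R
  open LabelSums R m′
  open Standardness m′

  weight : ∀ {n k} → Assign n m k → Carrier
  weight {n} {k} g = when (standardᵇ g) (pow q (inv n m k g))

  weight-cong : ∀ {n k} {g g′ : Assign n m k} → (∀ i c → g i c ≡ g′ i c) → weight g ≈ weight g′
  weight-cong g≗g′ = reflexive (cong₂ (λ b e → when b (pow q e)) (standardᵇ-cong g≗g′) (inv-cong g≗g′))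

  weight-¬standard : ∀ {n k} (g : Assign n m k) → standardᵇ g ≡ false → weight g ≈ 0#
  weight-¬standard g ¬s rewrite ¬s = ≈-refl

  S : ℕ → ℕ → Carrier
  S n k = ∑ (allAssign n m k) weight

  Sq≈S : ∀ n k → Sq q m n k ≈ S n k
  Sq≈S n k = ∑-filter standardᵇ (λ g → pow q (inv n m k g)) (allAssign n m k)

  Rows : ∀ k → List (Fin m → Label k m)
  Rows k = allFuns m (allLabels k m)

  weight-standard : ∀ {n k} (g : Assign n m k) → standardᵇ g ≡ true → weight g ≡ pow q (inv n m k g)
  weight-standard g s rewrite s = refl

  weight-snoc-row : ∀ {n k} (f : Assign n m k) (y : Label k m) (t : Fin m′ → Label k m) →
    weight (snoc f (consF y t)) ≈ when (allB λ i → labEq (t i) (rot y (suc i))) (weight (snoc f (consF y t)))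
  weight-snoc-row f y t with allB (λ i → labEq (t i) (rot y (suc i))) in rotated
  ... | true = ≈-refl
  ... | false = weight-¬standard g (¬-not λ sg →
    contradictionᵇ (allB-true⁺ _ λ i → labEq-≡ (row-rot sg (suc i))) rotated)
    where
    g = snoc f (consF y t)
    open Snoc f (consF y t) using (equivariantᵇ-snoc)
    row-rot : standardᵇ g ≡ true → ∀ c → consF y t c ≡ rot y c
    row-rot sg = rowEquivariant⁻ (consF y t) (∧-conicalʳ (equivariantᵇ f) _
      (trans (sym equivariantᵇ-snoc) (Standard.equivariant (standard⁻ g sg))))

  ∑-rows : ∀ {n k} (f : Assign n m k) →
    ∑[ h ∈ Rows k ] weight (snoc f h) ≈ ∑[ y ∈ allLabels k m ] weight (snoc f (rot y))
  ∑-rows {n} {k} f = ≈-trans (∑-allFuns-suc m′ L _) (∑-cong L λ y → begin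
    ∑[ t ∈ allFuns m′ L ] weight (snoc f (consF y t))
      ≈⟨ ∑-cong (allFuns m′ L) (weight-snoc-row f y) ⟩
    ∑[ t ∈ allFuns m′ L ] when (allB λ i → labEq (t i) (rot y (suc i))) (weight (snoc f (consF y t)))
      ≈⟨ ∑-allFuns-delta L labEq (∑-allLabels-delta k) m′ (rot y ∘ suc) (λ t → weight (snoc f (consF y t)))
           (λ t t′ t≗t′ → weight-cong (snoc-congʳ f λ { zero → refl ; (suc i) → t≗t′ i })) ⟩
    weight (snoc f (consF y (rot y ∘ suc)))
      ≈⟨ weight-cong (snoc-congʳ f λ { zero → rot-zero y ; (suc i) → refl }) ⟩
    weight (snoc f (rot y)) ∎)
    where
    L = allLabels k m

  -- The part of weight (snoc f (rot y)) not accounted for by extending f: the new base opens the last group.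
  newGroupTerm : ∀ {n} k → Assign n m k → Label k m → Carrier
  newGroupTerm zero f y = 0#
  newGroupTerm (suc k′) f y = when (labEq y opener ∧ avoidsLastᵇ f) (weight (snoc f (rot opener)))

  newGroupTerm-standard : ∀ {n} k (f : Assign n m k) y → standardᵇ f ≡ true → newGroupTerm k f y ≈ 0#
  newGroupTerm-standard zero f y sf = ≈-refl
  newGroupTerm-standard (suc k′) f y sf = begin
    when (labEq y opener ∧ avoidsLastᵇ f) w ≡⟨ cong (λ b → when (labEq y opener ∧ b) w) ¬avoids ⟩
    when (labEq y opener ∧ false) w         ≡⟨ cong (λ b → when b w) (∧-zeroʳ (labEq y opener)) ⟩
    0#                                      ∎
    where
    w = weight (snoc f (rot opener))
    ¬avoids : avoidsLastᵇ f ≡ false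
    ¬avoids = ¬-not λ av → contradictionᵇ sf (avoids⇒¬standard f av)

  module _ {n : ℕ} (k : ℕ) (f : Assign n m k) (y : Label k m) where

    private
      g = snoc f (rot y)
      rhs = weight f * pow q (blocksAbove k (idx m y)) + newGroupTerm k f y

    weight-snoc-extends : standardᵇ f ≡ true → weight g ≈ rhs
    weight-snoc-extends sf = begin
      weight g                                                    ≡⟨ weight-standard g (standard-snoc sf (rowEquivariant-rot y)) ⟩
      pow q (inv _ m k g)                                         ≡⟨ cong (pow q) (inv-snoc full) ⟩
      pow q (inv n m k f Nat.+ blocksAbove k (idx m (rot y zero)))  ≈⟨ pow-+ q (inv n m k f) (blocksAbove k (idx m (rot y zero))) ⟩
      pow q (inv n m k f) * pow q (blocksAbove k (idx m (rot y zero)))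
        ≡⟨ cong₂ (λ w y → w * pow q (blocksAbove k (idx m y))) (sym (weight-standard f sf)) (sym (rot-zero y)) ⟩
      weight f * pow q (blocksAbove k (idx m y))                  ≈⟨ +-identityʳ _ ⟨
      weight f * pow q (blocksAbove k (idx m y)) + 0#             ≈⟨ +-congˡ (newGroupTerm-standard k f y sf) ⟨
      rhs                                                         ∎
      where
      open Snoc f (rot y) using (standard-snoc; inv-snoc)
      full = covering⇒full f (Standard.covering (standard⁻ f sf))

  weight-snoc-opens : ∀ {n} k (f : Assign n m k) y → standardᵇ f ≡ false → standardᵇ (snoc f (rot y)) ≡ true →
    weight (snoc f (rot y)) ≈ newGroupTerm k f y
  weight-snoc-opens zero f y ¬sf sg = ⊥-elim (¬Fin0 (proj₁ (Snoc.opens-new-group f (rot y) sg ¬sf)))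
  weight-snoc-opens (suc k′) f y ¬sf sg = begin
    weight (snoc f (rot y))       ≡⟨ cong (λ y → weight (snoc f (rot y))) y≡opener ⟩
    weight (snoc f (rot opener))  ≡⟨ when-true (weight (snoc f (rot opener))) (cong₂ _∧_ (labEq-≡ y≡opener) avoids) ⟨
    newGroupTerm (suc k′) f y     ∎
    where
    opening = Snoc.opens-new-group f (rot y) sg ¬sf
    l₀ = proj₁ opening
    l₀≡last : l₀ ≡ fromℕ k′
    l₀≡last = maximal⇒fromℕ l₀ (proj₂ (proj₂ (proj₂ opening)))
    y≡opener : y ≡ opener
    y≡opener = trans (rot-zero y) (trans (proj₁ (proj₂ opening)) (cong (λ l → just (l , zero)) l₀≡last))
    avoids : avoidsLastᵇ f ≡ true
    avoids = missing⇒avoids f (subst (λ l → occursᵇ f l ≡ false) l₀≡last (proj₁ (proj₂ (proj₂ opening))))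

  newGroupTerm-¬standard : ∀ {n} k (f : Assign n m k) y → standardᵇ (snoc f (rot y)) ≡ false → newGroupTerm k f y ≈ 0#
  newGroupTerm-¬standard zero f y _ = ≈-refl
  newGroupTerm-¬standard (suc k′) f y ¬sg with labEq y opener in y-opener
  ... | false = ≈-refl
  ... | true = ≈-trans (when-cong (avoidsLastᵇ f) (weight-¬standard (snoc f (rot opener))
                         (subst (λ y → standardᵇ (snoc f (rot y)) ≡ false) (labEq-true⁻ y opener y-opener) ¬sg)))
                       (when-0 (avoidsLastᵇ f))

  weight-¬standard-*+ : ∀ {n k} (f : Assign n m k) u t → standardᵇ f ≡ false → weight f * u + t ≈ t
  weight-¬standard-*+ f u t ¬sf = ≈-trans (+-congʳ (≈-trans (*-congʳ (weight-¬standard f ¬sf)) (zeroˡ _))) (+-identityˡ _)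

  weight-snoc-rot : ∀ {n} k (f : Assign n m k) y →
    weight (snoc f (rot y)) ≈ weight f * pow q (blocksAbove k (idx m y)) + newGroupTerm k f y
  weight-snoc-rot k f y with standardᵇ f ≟ true | standardᵇ (snoc f (rot y)) ≟ true
  ... | yes sf | _ = weight-snoc-extends k f y sf
  ... | no ¬sf | yes sg = ≈-trans (weight-snoc-opens k f y (¬-not ¬sf) sg) (≈-sym (weight-¬standard-*+ f _ _ (¬-not ¬sf)))
  ... | no ¬sf | no ¬sg = begin
    weight (snoc f (rot y))  ≈⟨ weight-¬standard (snoc f (rot y)) (¬-not ¬sg) ⟩
    0#                       ≈⟨ newGroupTerm-¬standard k f y (¬-not ¬sg) ⟨
    newGroupTerm k f y       ≈⟨ weight-¬standard-*+ f _ _ (¬-not ¬sf) ⟨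
    weight f * pow q (blocksAbove k (idx m y)) + newGroupTerm k f y ∎

  avoidTerm : ∀ {n} k → Assign n m k → Carrier
  avoidTerm zero f = 0#
  avoidTerm (suc k′) f = when (avoidsLastᵇ f) (weight (snoc f (rot opener)))

  ∑-newGroupTerm : ∀ {n} k (f : Assign n m k) → ∑[ y ∈ allLabels k m ] newGroupTerm k f y ≈ avoidTerm k f
  ∑-newGroupTerm zero f = ∑-0 (allLabels zero m)
  ∑-newGroupTerm (suc k′) f = ≈-trans
    (∑-cong (allLabels (suc k′) m) λ y → reflexive (when-∧ (labEq y opener) (avoidsLastᵇ f) (weight (snoc f (rot opener)))))
    (∑-allLabels-delta (suc k′) opener (λ _ → avoidTerm (suc k′) f))

  ∑-weight-snoc-rot : ∀ {n} k (f : Assign n m k) →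
    ∑[ y ∈ allLabels k m ] weight (snoc f (rot y)) ≈ weight f * qint q (suc (k Nat.* m)) + avoidTerm k f
  ∑-weight-snoc-rot k f = begin
    ∑[ y ∈ L ] weight (snoc f (rot y))
      ≈⟨ ∑-cong L (weight-snoc-rot k f) ⟩
    ∑[ y ∈ L ] (weight f * pow q (blocksAbove k (idx m y)) + newGroupTerm k f y)
      ≈⟨ ∑-+ L _ _ ⟩
    ∑[ y ∈ L ] (weight f * pow q (blocksAbove k (idx m y))) + ∑ L (newGroupTerm k f)
      ≈⟨ +-cong (≈-trans (∑-*ˡ L (weight f) _) (*-congˡ (∑-allLabels-blocksAbove q k))) (∑-newGroupTerm k f) ⟩
    weight f * qint q (suc (k Nat.* m)) + avoidTerm k f ∎
    where
    L = allLabels k m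

  ∑-avoidsLast : ∀ n k′ (G : Assign n m (suc k′) → Carrier) → (∀ f f′ → (∀ i c → f i c ≡ f′ i c) → G f ≈ G f′) →
    ∑[ f ∈ allAssign n m (suc k′) ] when (avoidsLastᵇ f) (G f) ≈ ∑[ f′ ∈ allAssign n m k′ ] G (λ i c → embed (f′ i c))
  ∑-avoidsLast n k′ G G-cong =
    ∑-allFuns-restrict (λ h h′ → ∀ c → h c ≡ h′ c) (λ h c → refl) (Rows (suc k′)) (Rows k′)
      (λ h′ c → embed (h′ c)) (λ h → allB λ c → not (lastGroupᵇ (h c)))
      (λ H H-cong → ∑-allFuns-restrict _≡_ (λ _ → refl) (allLabels (suc k′) m) (allLabels k′ m) embed (not ∘ lastGroupᵇ)
                      (λ H′ _ → ∑-allLabels-avoid k′ H′) m H H-cong)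
      n G G-cong

  module _ {n k′ : ℕ} (f′ : Assign n m k′) where
    open NewGroup f′ using (g; standardᵇ-new; inv-new)

    weight-newGroup : weight g ≈ weight f′
    weight-newGroup with standardᵇ f′ ≟ true
    ... | yes s = begin
      weight g              ≡⟨ weight-standard g (trans standardᵇ-new s) ⟩
      pow q (inv _ m _ g)   ≡⟨ cong (pow q) (inv-new (covering⇒full f′ (Standard.covering (standard⁻ f′ s)))) ⟩
      pow q (inv _ m _ f′)  ≡⟨ weight-standard f′ s ⟨
      weight f′             ∎
    ... | no ¬s = ≈-trans (weight-¬standard g (trans standardᵇ-new (¬-not ¬s))) (≈-sym (weight-¬standard f′ (¬-not ¬s)))

  S-below : ℕ → ℕ → Carrier
  S-below n zero = 0#
  S-below n (suc k′) = S n k′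

  ∑-avoidTerm : ∀ n k → ∑[ f ∈ allAssign n m k ] avoidTerm k f ≈ S-below n k
  ∑-avoidTerm n zero = ∑-0 (allAssign n m zero)
  ∑-avoidTerm n (suc k′) = ≈-trans
    (∑-avoidsLast n k′ (λ f → weight (snoc f (rot opener))) (λ f f′ f≗f′ → weight-cong (snoc-congˡ f≗f′)))
    (∑-cong (allAssign n m k′) weight-newGroup)

  S-suc : ∀ n k → S (suc n) k ≈ S n k * qint q (suc (k Nat.* m)) + S-below n k
  S-suc n k = begin
    S (suc n) k
      ≈⟨ ∑-allFuns-snoc n (Rows k) weight (λ g g′ g≗g′ → weight-cong λ i c → cong (λ row → row c) (g≗g′ i)) ⟩
    ∑[ h ∈ Rows k ] ∑[ f ∈ A ] weight (snoc f h)
      ≈⟨ ∑-swap (Rows k) A _ ⟩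
    ∑[ f ∈ A ] ∑[ h ∈ Rows k ] weight (snoc f h)
      ≈⟨ ∑-cong A ∑-rows ⟩
    ∑[ f ∈ A ] ∑[ y ∈ allLabels k m ] weight (snoc f (rot y))
      ≈⟨ ∑-cong A (∑-weight-snoc-rot k) ⟩
    ∑[ f ∈ A ] (weight f * qint q (suc (k Nat.* m)) + avoidTerm k f)
      ≈⟨ ∑-+ A _ _ ⟩
    ∑[ f ∈ A ] (weight f * qint q (suc (k Nat.* m))) + ∑ A (avoidTerm k)
      ≈⟨ +-cong (∑-*ʳ A _ weight) (∑-avoidTerm n k) ⟩
    S n k * qint q (suc (k Nat.* m)) + S-below n k ∎
    where
    A = allAssign n m k

  -- With no bases, the empty assignment is standard (with no inversions) exactly when k = 0.
  S-0-0 : S 0 0 ≈ 1#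
  S-0-0 = +-identityʳ _

  S-0-suc : ∀ k → S 0 (suc k) ≈ 0#
  S-0-suc k = +-identityʳ _

  S-vanishes : ∀ n k → n < k → S n k ≈ 0#
  S-vanishes zero (suc k) _ = S-0-suc k
  S-vanishes (suc n) (suc k) (s≤s n<k) = ≈-trans (S-suc n (suc k)) (≈-trans
    (+-cong (≈-trans (*-congʳ (S-vanishes n (suc k) (m≤n⇒m≤1+n n<k))) (zeroˡ _)) (S-vanishes n k n<k))
    (+-identityʳ 0#))

module AlternatingSum {c ℓ} (R : CommutativeRing c ℓ) (q : CommutativeRing.Carrier R) (m′ : ℕ) where
  open CommutativeRing R hiding (zero) renaming (refl to ≈-refl; sym to ≈-sym; trans to ≈-trans)
  open import Algebra.Properties.Semiring.Sum semiring using (∑-distrib-+; *-distribˡ-sum; sum-cong-≋)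
  open import Relation.Binary.Reasoning.Setoid setoid
  open import Data.Nat.Properties using (≤-refl; ≤-pred; +-∸-assoc; +-suc)
  open QAnalogues R
  open Sums R using (∑-upTo; qint-+)
  open SumUpTo +-commutativeMonoid
  open Recurrence R q m′
  open Colours m′ using (m)

  x : Carrier
  x = - pow q m′

  a b : ℕ → Carrier
  a k = qint q (suc k Nat.* m)
  b k = qint q (suc (k Nat.* m))

  U : ℕ → ℕ → Carrier
  U n k = qfactm q m k * S n k

  U-suc-zero : ∀ n → U (suc n) 0 ≈ b 0 * U n 0
  U-suc-zero n = begin
    1# * S (suc n) 0       ≈⟨ *-identityˡ _ ⟩
    S (suc n) 0            ≈⟨ S-suc n 0 ⟩
    S n 0 * b 0 + 0#       ≈⟨ +-identityʳ _ ⟩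
    S n 0 * b 0            ≈⟨ *-comm _ _ ⟩
    b 0 * S n 0            ≈⟨ *-congˡ (*-identityˡ _) ⟨
    b 0 * (1# * S n 0)     ∎

  U-suc-suc : ∀ n k → U (suc n) (suc k) ≈ a k * U n k + b (suc k) * U n (suc k)
  U-suc-suc n k = begin
    (F * a k) * S (suc n) (suc k)                              ≈⟨ *-congˡ (S-suc n (suc k)) ⟩
    (F * a k) * (S n (suc k) * b (suc k) + S n k)              ≈⟨ distribˡ _ _ _ ⟩
    (F * a k) * (S n (suc k) * b (suc k)) + (F * a k) * S n k  ≈⟨ +-comm _ _ ⟩
    (F * a k) * S n k + (F * a k) * (S n (suc k) * b (suc k))  ≈⟨ +-cong reassocˡ reassocʳ ⟩
    a k * (F * S n k) + b (suc k) * ((F * a k) * S n (suc k))  ∎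
    where
    F = qfactm q m k
    reassocˡ : (F * a k) * S n k ≈ a k * (F * S n k)
    reassocˡ = ≈-trans (*-congʳ (*-comm F (a k))) (*-assoc _ _ _)
    reassocʳ : (F * a k) * (S n (suc k) * b (suc k)) ≈ b (suc k) * ((F * a k) * S n (suc k))
    reassocʳ = ≈-trans (≈-sym (*-assoc _ _ _)) (*-comm _ _)

  a+x*b : ∀ k → a k + x * b k ≈ qint q m′
  a+x*b k = begin
    a k + x * b k                            ≡⟨ cong (λ N → qint q N + x * b k) (+-suc m′ (k Nat.* m)) ⟨
    qint q (m′ Nat.+ suc (k Nat.* m)) + x * b k  ≈⟨ +-congʳ (qint-+ q m′ (suc (k Nat.* m))) ⟩
    (qint q m′ + pow q m′ * b k) + x * b k   ≈⟨ +-assoc _ _ _ ⟩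
    qint q m′ + (pow q m′ * b k + x * b k)   ≈⟨ +-congˡ (distribʳ (b k) (pow q m′) x) ⟨
    qint q m′ + (pow q m′ + x) * b k         ≈⟨ +-congˡ (≈-trans (*-congʳ (-‿inverseʳ (pow q m′))) (zeroˡ _)) ⟩
    qint q m′ + 0#                           ≈⟨ +-identityʳ _ ⟩
    qint q m′                                ∎

  alternating : ℕ → Carrier
  alternating n = sumUpTo (suc n) (λ k → pow x (n ∸ k) * U n k)

  combine : ∀ n k → k ≤ n →
    pow x (n ∸ k) * (a k * U n k) + pow x (suc n ∸ k) * (b k * U n k) ≈ qint q m′ * (pow x (n ∸ k) * U n k)
  combine n k k≤n = begin
    p * (a k * u) + pow x (suc n ∸ k) * (b k * u) ≡⟨ cong (λ e → p * (a k * u) + pow x e * (b k * u)) (+-∸-assoc 1 k≤n) ⟩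
    p * (a k * u) + (x * p) * (b k * u)           ≈⟨ +-congˡ (≈-trans (*-congʳ (*-comm x p)) (*-assoc _ _ _)) ⟩
    p * (a k * u) + p * (x * (b k * u))           ≈⟨ distribˡ p _ _ ⟨
    p * (a k * u + x * (b k * u))                 ≈⟨ *-congˡ (+-congˡ (*-assoc _ _ _)) ⟨
    p * (a k * u + (x * b k) * u)                 ≈⟨ *-congˡ (distribʳ u _ _) ⟨
    p * ((a k + x * b k) * u)                     ≈⟨ *-congˡ (*-congʳ (a+x*b k)) ⟩
    p * (qint q m′ * u)                           ≈⟨ x∙yz≈y∙xz p (qint q m′) u ⟩
    qint q m′ * (p * u)                           ∎
    where
    open import Algebra.Properties.CommutativeSemigroup *-commutativeSemigroup using (x∙yz≈y∙xz)
    p = pow x (n ∸ k)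
    u = U n k

  alternating-suc : ∀ n → alternating (suc n) ≈ qint q m′ * alternating n
  alternating-suc n = begin
    pow x (suc n) * U (suc n) 0 + sumUpTo (suc n) (λ k → pow x (n ∸ k) * U (suc n) (suc k))
      ≈⟨ +-cong (*-congˡ (U-suc-zero n)) (sumUpTo-cong (suc n) split) ⟩
    ψ 0 + sumUpTo (suc n) (λ k → φ k + ψ (suc k))
      ≈⟨ +-congˡ (∑-distrib-+ {suc n} (φ ∘ toℕ) (ψ ∘ suc ∘ toℕ)) ⟩
    ψ 0 + (sumUpTo (suc n) φ + sumUpTo (suc n) (ψ ∘ suc))
      ≈⟨ x∙yz≈y∙xz (ψ 0) (sumUpTo (suc n) φ) (sumUpTo (suc n) (ψ ∘ suc)) ⟩
    sumUpTo (suc n) φ + sumUpTo (suc (suc n)) ψ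
      ≈⟨ +-congˡ (sumUpTo-last (suc n) ψ) ⟩
    sumUpTo (suc n) φ + (sumUpTo (suc n) ψ + ψ (suc n))
      ≈⟨ +-congˡ (≈-trans (+-congˡ ψ-beyond) (+-identityʳ _)) ⟩
    sumUpTo (suc n) φ + sumUpTo (suc n) ψ
      ≈⟨ ∑-distrib-+ {suc n} (φ ∘ toℕ) (ψ ∘ toℕ) ⟨
    sumUpTo (suc n) (λ k → φ k + ψ k)
      ≈⟨ sum-cong-≋ {suc n} (λ i → combine n (toℕ i) (≤-pred (toℕ<n i))) ⟩
    sumUpTo (suc n) (λ k → qint q m′ * (pow x (n ∸ k) * U n k))
      ≈⟨ *-distribˡ-sum {suc n} (qint q m′) (λ i → pow x (n ∸ toℕ i) * U n (toℕ i)) ⟨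
    qint q m′ * alternating n ∎
    where
    open import Algebra.Properties.CommutativeSemigroup +-commutativeSemigroup using (x∙yz≈y∙xz)
    φ ψ : ℕ → Carrier
    φ k = pow x (n ∸ k) * (a k * U n k)
    ψ k = pow x (suc n ∸ k) * (b k * U n k)
    split : ∀ k → pow x (n ∸ k) * U (suc n) (suc k) ≈ φ k + ψ (suc k)
    split k = ≈-trans (*-congˡ (U-suc-suc n k)) (distribˡ (pow x (n ∸ k)) (a k * U n k) (b (suc k) * U n (suc k)))
    ψ-beyond : ψ (suc n) ≈ 0#
    ψ-beyond = begin
      p * (b (suc n) * (qfactm q m (suc n) * S n (suc n))) ≈⟨ *-congˡ (*-congˡ (*-congˡ (S-vanishes n (suc n) ≤-refl))) ⟩
      p * (b (suc n) * (qfactm q m (suc n) * 0#))          ≈⟨ *-congˡ (*-congˡ (zeroʳ _)) ⟩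
      p * (b (suc n) * 0#)                                 ≈⟨ *-congˡ (zeroʳ _) ⟩
      p * 0#                                               ≈⟨ zeroʳ _ ⟩
      0#                                                   ∎
      where p = pow x (n ∸ n)

  alternating≈pow : ∀ n → alternating n ≈ pow (qint q m′) n
  alternating≈pow zero = begin
    1# * (1# * S 0 0) + 0#  ≈⟨ +-identityʳ _ ⟩
    1# * (1# * S 0 0)       ≈⟨ ≈-trans (*-identityˡ _) (*-identityˡ _) ⟩
    S 0 0                   ≈⟨ S-0-0 ⟩
    1#                      ∎
  alternating≈pow (suc n) = ≈-trans (alternating-suc n) (*-congˡ (alternating≈pow n))

  alternating-sum : ∀ n →
    sumR (map (λ k → pow x (n ∸ k) * SoCR q m n k) (upTo (suc n))) ≈ pow (qint q m′) n
  alternating-sum n = begin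
    sumR (map (λ k → pow x (n ∸ k) * SoCR q m n k) (upTo (suc n)))
      ≡⟨ ∑-upTo (suc n) (λ k → pow x (n ∸ k) * SoCR q m n k) ⟩
    sumUpTo (suc n) (λ k → pow x (n ∸ k) * SoCR q m n k)
      ≈⟨ sumUpTo-cong (suc n) (λ k → *-congˡ {pow x (n ∸ k)} (*-congˡ {qfactm q m k} (Sq≈S n k))) ⟩
    alternating n
      ≈⟨ alternating≈pow n ⟩
    pow (qint q m′) n ∎

theorem4p12 : ∀ {c ℓ} (R : CommutativeRing c ℓ) (q : CommutativeRing.Carrier R)
    (m n : ℕ) → {{_ : NonZero m}} →
    let open CommutativeRing R
        open QAnalogues R
    in sumR (map (λ k → pow (- pow q (m ∸ 1)) (n ∸ k) * SoCR q m n k) (upTo (suc n)))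
       ≈ pow (qint q (m ∸ 1)) n
theorem4p12 R q (suc m′) n = AlternatingSum.alternating-sum R q m′ n
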